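{- Let $G$ be a finite group. Then $G$ is Cay-DS if and only if every quotient group $G/N$ ($N$ a normal subgroup of $G$) is Cay-DS.
   Context: For a finite group $G$ and a subset $S\subseteq G\setminus\{1\}$ with $S=S^{ -1}$, the Cayley graph $Cay(G,S)$ has vertex set $G$, with $a,b$ adjacent iff $ab^{ -1}\in S$. The spectrum of a graph is the multiset of eigenvalues of its adjacency matrix. A finite group $G$ is Cay-DS if every Cayley graph $\Gamma$ on $G$ is isomorphic to every Cayley graph $\Gamma'$ (on any finite group) with the same spectrum as $\Gamma$. -}

module Defs where

open import Data.Nat using (ℕ; zero; suc)
open import Data.Fin using (Fin; zero; suc; punchIn; _≟_)
open import Data.Integer as ℤ using (ℤ)
open import Data.List using (List; []; _∷_; map)
open import Data.Bool using (Bool; true; false; if_then_else_)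
open import Data.Product using (Σ; ∃; _×_; _,_)
open import Function using (_∘_)
open import Function.Bundles using (_↔_; Inverse)
open import Relation.Nullary.Decidable using (⌊_⌋)
open import Relation.Binary.PropositionalEquality using (_≡_)

-- Finite groups: a group structure on the finite set Fin n
-- (every finite group of order n is isomorphic to such a structure).

record FinGroup (n : ℕ) : Set where
  field
    _∙_   : Fin n → Fin n → Fin n
    e     : Fin n
    inv   : Fin n → Fin n
    assoc : ∀ x y z → (x ∙ y) ∙ z ≡ x ∙ (y ∙ z)
    idˡ   : ∀ x → e ∙ x ≡ x
    idʳ   : ∀ x → x ∙ e ≡ x
    invˡ  : ∀ x → inv x ∙ x ≡ e
    invʳ  : ∀ x → x ∙ inv x ≡ e

open FinGroup public

IsConnectionSet : ∀ {n} → FinGroup n → (Fin n → Bool) → Set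
IsConnectionSet G S = (S (e G) ≡ false) × (∀ x → S (inv G x) ≡ S x)

cayAdj : ∀ {n} → FinGroup n → (Fin n → Bool) → Fin n → Fin n → Bool
cayAdj G S a b = S (_∙_ G a (inv G b))

cayMatrix : ∀ {n} → FinGroup n → (Fin n → Bool) → Fin n → Fin n → ℤ
cayMatrix G S a b = if cayAdj G S a b then ℤ.+ 1 else ℤ.+ 0

CayIso : ∀ {n m} → (G : FinGroup n) → (Fin n → Bool)
       → (H : FinGroup m) → (Fin m → Bool) → Set
CayIso {n} {m} G S H T =
  Σ (Fin n ↔ Fin m) λ f →
    ∀ a b → cayAdj G S a b ≡ cayAdj H T (Inverse.to f a) (Inverse.to f b)

-- Polynomials over ℤ as coefficient lists (lowest degree first).

Poly : Set
Poly = List ℤ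

infixl 6 _+ₚ_
infixl 7 _*ₚ_

_+ₚ_ : Poly → Poly → Poly
[] +ₚ q = q
(a ∷ p) +ₚ [] = a ∷ p
(a ∷ p) +ₚ (b ∷ q) = (a ℤ.+ b) ∷ (p +ₚ q)

negₚ : Poly → Poly
negₚ = map (λ a → ℤ.- a)

scaleₚ : ℤ → Poly → Poly
scaleₚ c = map (c ℤ.*_)

_*ₚ_ : Poly → Poly → Poly
[] *ₚ q = []
(a ∷ p) *ₚ q = scaleₚ a q +ₚ (ℤ.+ 0 ∷ (p *ₚ q))

constₚ : ℤ → Poly
constₚ c = c ∷ []

Xₚ : Poly
Xₚ = ℤ.+ 0 ∷ ℤ.+ 1 ∷ []

coeff : Poly → ℕ → ℤ
coeff [] _ = ℤ.+ 0
coeff (a ∷ p) zero = a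
coeff (a ∷ p) (suc i) = coeff p i

-- equality of polynomials (coefficientwise; ignores trailing zeros)
_≈ₚ_ : Poly → Poly → Set
p ≈ₚ q = ∀ i → coeff p i ≡ coeff q i

Σₚ : ∀ n → (Fin n → Poly) → Poly
Σₚ zero f = []
Σₚ (suc n) f = f zero +ₚ Σₚ n (f ∘ suc)

altₚ : ℕ → Poly → Poly
altₚ zero p = p
altₚ (suc k) p = negₚ (altₚ k p)

det : ∀ n → (Fin n → Fin n → Poly) → Poly
det zero M = constₚ (ℤ.+ 1)
det (suc n) M =
  Σₚ (suc n) λ j →
    altₚ (Data.Fin.toℕ j) (M zero j *ₚ det n (λ i k → M (suc i) (punchIn j k)))

charPoly : ∀ n → (Fin n → Fin n → ℤ) → Poly
charPoly n A =
  det n λ i j → (if ⌊ i ≟ j ⌋ then Xₚ else []) +ₚ negₚ (constₚ (A i j))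

-- cospectral Cayley graphs: adjacency matrices have the same
-- characteristic polynomial (= same multiset of eigenvalues)
CayCospectral : ∀ {n m} → (G : FinGroup n) → (Fin n → Bool)
              → (H : FinGroup m) → (Fin m → Bool) → Set
CayCospectral {n} {m} G S H T =
  charPoly n (cayMatrix G S) ≈ₚ charPoly m (cayMatrix H T)

CayDS : ∀ {n} → FinGroup n → Set
CayDS {n} G =
  ∀ (S : Fin n → Bool) → IsConnectionSet G S →
  ∀ m (H : FinGroup m) (T : Fin m → Bool) → IsConnectionSet H T →
  CayCospectral G S H T → CayIso G S H T

IsNormalSubgroup : ∀ {n} → FinGroup n → (Fin n → Bool) → Set
IsNormalSubgroup G N =
  (N (e G) ≡ true) ×
  (∀ x y → N x ≡ true → N y ≡ true → N (_∙_ G x y) ≡ true) ×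
  (∀ x → N x ≡ true → N (inv G x) ≡ true) ×
  (∀ g x → N x ≡ true → N (_∙_ G (_∙_ G g x) (inv G g)) ≡ true)

IsHom : ∀ {n k} → FinGroup n → FinGroup k → (Fin n → Fin k) → Set
IsHom G Q φ = ∀ x y → φ (_∙_ G x y) ≡ _∙_ Q (φ x) (φ y)

Surj : ∀ {n k} → (Fin n → Fin k) → Set
Surj φ = ∀ q → ∃ λ x → φ x ≡ q

KernelIs : ∀ {n k} → FinGroup n → FinGroup k → (Fin n → Fin k) → (Fin n → Bool) → Set
KernelIs G Q φ N = ∀ x → (φ x ≡ e Q → N x ≡ true) × (N x ≡ true → φ x ≡ e Q)

-- Q is (a copy of) the quotient group G/N: there is a surjective
-- homomorphism G → Q with kernel N (first isomorphism theorem).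
IsQuotientBy : ∀ {n k} → FinGroup n → (Fin n → Bool) → FinGroup k → Set
IsQuotientBy {n} {k} G N Q =
  Σ (Fin n → Fin k) λ φ → IsHom G Q φ × Surj φ × KernelIs G Q φ N

-- ⇐ holds because G is its own quotient by the trivial subgroup. For ⇒, let φ : G → Q be onto, with kernel of
-- size m, and let Cay (Q, S) and Cay (H, T) be cospectral. Pulling S back along φ gives Cay (G, S ∘ φ), the blow-up
-- of Cay (Q, S) in which each vertex becomes m pairwise non-adjacent twins; likewise T ∘ φ on the group H × ker φ,
-- carried by the underlying set of G, gives the blow-up of Cay (H, T). As det (x I - A ∘ φ) = x ^ (|G| - |Q|) ·
-- det (x I - m A), blow-ups of cospectral graphs are cospectral, so the two blow-ups are isomorphic because G is
-- Cay-DS. Finally, blow-ups cancel: an isomorphism between them can be pushed down to the quotient graphs and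
-- corrected inside classes of twin vertices.

module Submission where

open import Defs hiding (det)
open import Data.Bool using (Bool; true; if_then_else_)
import Data.Bool.Properties as BoolP
open import Data.Empty using (⊥-elim)
open import Data.Fin using (Fin; zero; suc; toℕ; punchIn; punchOut; inject₁)
import Data.Fin.Properties as FinP
open import Data.Fin.Permutation using (insert; insert-punchIn; _⟨$⟩ʳ_)
import Data.Fin.Permutation as Perm
open import Data.Integer as ℤ using (ℤ; 0ℤ; 1ℤ; -_; _+_; _*_; _-_; _^_)
import Data.Integer.Properties as ℤP
open import Data.Integer.Tactic.RingSolver using (solve-∀)
open import Data.List using ([]; _∷_; allFin; length)
open import Data.List.Membership.Propositional using (_∉_)
open import Data.List.Membership.Propositional.Properties using (∈-allFin)
open import Data.List.Relation.Unary.Any using (here; there)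
open import Data.Nat as ℕ using (ℕ; zero; suc; _∸_; z≤n; s≤s; _<_)
import Data.Nat.Properties as ℕP
open import Data.Product using (Σ; ∃; _,_; proj₁; proj₂)
open import Data.Sum using (inj₁; inj₂)
open import Function using (_∘_; Injective)
open import Function.Bundles using (_⇔_; mk⇔; _↔_; mk↔ₛ′; Inverse)
open import Level using (0ℓ)
open import Relation.Binary using (tri<; tri≈; tri>)
open import Relation.Binary.Bundles using (DecSetoid)
open import Relation.Binary.PropositionalEquality
open import Relation.Nullary using (yes; no; Dec)
open import Relation.Nullary.Decidable using (⌊_⌋; ¬?; decidable-stable)
open import Algebra.Bundles using (Group)
import Algebra.Properties.Group as GroupProperties
open import Algebra.Properties.AbelianGroup ℤP.+-0-abelianGroup using ()
  renaming (identityˡ-unique to +-identityˡ-unique; ∙-cancelˡ to +-cancelˡ)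
open import Algebra.Properties.Semiring.Sum ℤP.+-*-semiring
  using (sum; sum-cong-≗; ∑-comm; sum-remove; ∑-distrib-+; sum-permute; sum-replicate-zero; *-distribˡ-sum; *-distribʳ-sum)

open ≡-Reasoning

-- Finite sums and the Kronecker delta over ℤ

Matrix : ℕ → Set
Matrix n = Fin n → Fin n → ℤ

sum-zero : ∀ {n} (f : Fin n → ℤ) → (∀ i → f i ≡ 0ℤ) → sum f ≡ 0ℤ
sum-zero {n} f f≡0 = trans (sum-cong-≗ f≡0) (sum-replicate-zero n)

neg-distrib-sum : ∀ {n} (f : Fin n → ℤ) → - sum f ≡ sum (λ i → - f i)
neg-distrib-sum {zero} f = refl
neg-distrib-sum {suc n} f =
  trans (ℤP.neg-distrib-+ (f zero) (sum (f ∘ suc))) (cong (- f zero +_) (neg-distrib-sum (f ∘ suc)))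

sum-linear : ∀ {n} a (f g : Fin n → ℤ) → sum (λ i → a * f i + g i) ≡ a * sum f + sum g
sum-linear a f g = trans (∑-distrib-+ (λ i → a * f i) g) (cong (_+ sum g) (sym (*-distribˡ-sum a f)))

sum-linear₃ : ∀ {n} a₁ a₂ a₃ (f₁ f₂ f₃ : Fin n → ℤ) →
              sum (λ c → a₁ * f₁ c + a₂ * f₂ c + a₃ * f₃ c) ≡ a₁ * sum f₁ + a₂ * sum f₂ + a₃ * sum f₃
sum-linear₃ a₁ a₂ a₃ f₁ f₂ f₃ = begin
  sum (λ c → a₁ * f₁ c + a₂ * f₂ c + a₃ * f₃ c)
    ≡⟨ ∑-distrib-+ (λ c → a₁ * f₁ c + a₂ * f₂ c) (λ c → a₃ * f₃ c) ⟩
  sum (λ c → a₁ * f₁ c + a₂ * f₂ c) + sum (λ c → a₃ * f₃ c)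
    ≡⟨ cong₂ _+_ (sum-linear a₁ f₁ (λ c → a₂ * f₂ c)) (sym (*-distribˡ-sum a₃ f₃)) ⟩
  a₁ * sum f₁ + sum (λ c → a₂ * f₂ c) + a₃ * sum f₃
    ≡⟨ cong (λ s → a₁ * sum f₁ + s + a₃ * sum f₃) (*-distribˡ-sum a₂ f₂) ⟨
  a₁ * sum f₁ + a₂ * sum f₂ + a₃ * sum f₃ ∎

sign : ℕ → ℤ
sign zero    = 1ℤ
sign (suc k) = - sign k

δ : ∀ {n} → Matrix n
δ zero    zero    = 1ℤ
δ zero    (suc _) = 0ℤ
δ (suc _) zero    = 0ℤ
δ (suc i) (suc j) = δ i j

δ-refl : ∀ {n} (i : Fin n) → δ i i ≡ 1ℤ
δ-refl zero    = refl
δ-refl (suc i) = δ-refl i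

δ-≢ : ∀ {n} {i j : Fin n} → i ≢ j → δ i j ≡ 0ℤ
δ-≢ {i = zero}  {zero}  i≢j = ⊥-elim (i≢j refl)
δ-≢ {i = zero}  {suc j} i≢j = refl
δ-≢ {i = suc i} {zero}  i≢j = refl
δ-≢ {i = suc i} {suc j} i≢j = δ-≢ (i≢j ∘ cong suc)

δ-sym : ∀ {n} (i j : Fin n) → δ i j ≡ δ j i
δ-sym zero    zero    = refl
δ-sym zero    (suc j) = refl
δ-sym (suc i) zero    = refl
δ-sym (suc i) (suc j) = δ-sym i j

δ-injective : ∀ {n m} (f : Fin n → Fin m) → Injective _≡_ _≡_ f → ∀ i j → δ (f i) (f j) ≡ δ i j
δ-injective f f-inj i j with i FinP.≟ j
... | yes refl = trans (δ-refl (f i)) (sym (δ-refl i))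
... | no i≢j   = trans (δ-≢ (i≢j ∘ f-inj)) (sym (δ-≢ i≢j))

sum-δˡ : ∀ {n} (r : Fin n) (f : Fin n → ℤ) → sum (λ c → δ r c * f c) ≡ f r
sum-δˡ {suc n} zero f = begin
  1ℤ * f zero + sum (λ c → 0ℤ * f (suc c))
    ≡⟨ cong₂ _+_ (ℤP.*-identityˡ (f zero)) (sum-zero _ (λ c → ℤP.*-zeroˡ (f (suc c)))) ⟩
  f zero + 0ℤ                              ≡⟨ ℤP.+-identityʳ (f zero) ⟩
  f zero                                   ∎
sum-δˡ {suc n} (suc r) f = trans (ℤP.+-identityˡ _) (sum-δˡ r (f ∘ suc))

sum-δʳ : ∀ {n} (r : Fin n) (f : Fin n → ℤ) → sum (λ c → f c * δ c r) ≡ f r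
sum-δʳ r f = trans (sum-cong-≗ (λ c → trans (ℤP.*-comm (f c) (δ c r)) (cong (_* f c) (δ-sym c r)))) (sum-δˡ r f)

sum-δ-pair : ∀ {n} (a a′ : Fin n) t (f : Fin n → ℤ) → sum (λ c → (δ a c + t * δ a′ c) * f c) ≡ f a + t * f a′
sum-δ-pair a a′ t f = begin
  sum (λ c → (δ a c + t * δ a′ c) * f c)          ≡⟨ sum-cong-≗ (λ c → distrib (δ a c) t (δ a′ c) (f c)) ⟩
  sum (λ c → t * (δ a′ c * f c) + δ a c * f c)    ≡⟨ sum-linear t (λ c → δ a′ c * f c) (λ c → δ a c * f c) ⟩
  t * sum (λ c → δ a′ c * f c) + sum (λ c → δ a c * f c)
    ≡⟨ cong₂ (λ u v → t * u + v) (sum-δˡ a′ f) (sum-δˡ a f) ⟩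
  t * f a′ + f a                                  ≡⟨ ℤP.+-comm (t * f a′) (f a) ⟩
  f a + t * f a′                                  ∎
  where
  distrib : ∀ d t d′ y → (d + t * d′) * y ≡ t * (d′ * y) + d * y
  distrib = solve-∀

x≡-x⇒x≡0 : ∀ x → x ≡ - x → x ≡ 0ℤ
x≡-x⇒x≡0 x x≡-x = ℤP.*-cancelˡ-≡ (ℤ.+ 2) x 0ℤ (trans (double x) (trans (cong (x +_) x≡-x) (ℤP.+-inverseʳ x)))
  where
  double : ∀ x → ℤ.+ 2 * x ≡ x + x
  double = solve-∀

sum-natural : ∀ {n} (f : Fin n → ℤ) → (∀ i → ∃ λ t → f i ≡ ℤ.+ t) → ∃ λ t → sum f ≡ ℤ.+ t
sum-natural {zero}  f natural = 0 , refl
sum-natural {suc n} f natural with natural zero | sum-natural (f ∘ suc) (natural ∘ suc)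
... | t , f₀≡t | t′ , rest≡t′ = t ℕ.+ t′ , cong₂ _+_ f₀≡t rest≡t′

δ-natural : ∀ {n} (i j : Fin n) → ∃ λ t → δ i j ≡ ℤ.+ t
δ-natural zero    zero    = 1 , refl
δ-natural zero    (suc j) = 0 , refl
δ-natural (suc i) zero    = 0 , refl
δ-natural (suc i) (suc j) = δ-natural i j

sum-natural-nonzero : ∀ {n} (f : Fin n → ℤ) i → f i ≡ 1ℤ → (∀ j → ∃ λ t → f j ≡ ℤ.+ t) → sum f ≢ 0ℤ
sum-natural-nonzero {suc n} f i fi≡1 natural ∑f≡0 with sum-natural (f ∘ punchIn i) (natural ∘ punchIn i)
... | t , rest≡t with trans (sym (trans (sum-remove {i = i} f) (cong₂ _+_ fi≡1 rest≡t))) ∑f≡0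
... | ()

sum-nonzero⇒term-nonzero : ∀ {n} (f : Fin n → ℤ) → sum f ≢ 0ℤ → ∃ λ i → f i ≢ 0ℤ
sum-nonzero⇒term-nonzero {zero}  f ∑f≢0 = ⊥-elim (∑f≢0 refl)
sum-nonzero⇒term-nonzero {suc n} f ∑f≢0 with f zero ℤP.≟ 0ℤ
... | no  f₀≢0 = zero , f₀≢0
... | yes f₀≡0 with sum-nonzero⇒term-nonzero (f ∘ suc) (λ rest≡0 → ∑f≢0 (trans (cong₂ _+_ f₀≡0 rest≡0) refl))
...   | i , fi≢0 = suc i , fi≢0

-- Determinants by Laplace expansion

minor : ∀ {n} → Matrix (suc n) → Fin (suc n) → Matrix n
minor M j i k = M (suc i) (punchIn j k)

det : ∀ n → Matrix n → ℤ
det zero    M = 1ℤ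
det (suc n) M = sum λ j → sign (toℕ j) * (M zero j * det n (minor M j))

det-cong : ∀ n {M N : Matrix n} → (∀ i j → M i j ≡ N i j) → det n M ≡ det n N
det-cong zero    M≡N = refl
det-cong (suc n) M≡N = sum-cong-≗ λ j →
  cong (λ x → sign (toℕ j) * x) (cong₂ _*_ (M≡N zero j) (det-cong n (λ i k → M≡N (suc i) (punchIn j k))))

RowsAgreeExcept : ∀ {n} → Fin n → Matrix n → Matrix n → Set
RowsAgreeExcept r M N = ∀ i → i ≢ r → ∀ j → M i j ≡ N i j

det-linear : ∀ n (M M₁ M₂ : Matrix n) r a → RowsAgreeExcept r M M₁ → RowsAgreeExcept r M M₂ →
             (∀ j → M r j ≡ a * M₁ r j + M₂ r j) → det n M ≡ a * det n M₁ + det n M₂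
det-linear (suc n) M M₁ M₂ r a M≈M₁ M≈M₂ row-r =
  trans (sum-cong-≗ (term r M≈M₁ M≈M₂ row-r)) (sum-linear a (expansion M₁) (expansion M₂))
  where
  expansion : Matrix (suc n) → Fin (suc n) → ℤ
  expansion N j = sign (toℕ j) * (N zero j * det n (minor N j))

  term : ∀ r → RowsAgreeExcept r M M₁ → RowsAgreeExcept r M M₂ → (∀ j → M r j ≡ a * M₁ r j + M₂ r j) →
         ∀ j → expansion M j ≡ a * expansion M₁ j + expansion M₂ j
  term zero M≈M₁ M≈M₂ row-0 j = begin
    s * (M zero j * det n (minor M j))
      ≡⟨ cong₂ (λ x d → s * (x * d)) (row-0 j) (det-cong n λ i k → M≈M₁ (suc i) (λ ()) (punchIn j k)) ⟩
    s * ((a * M₁ zero j + M₂ zero j) * det n (minor M₁ j))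
      ≡⟨ distrib s a (M₁ zero j) (M₂ zero j) (det n (minor M₁ j)) ⟩
    a * (s * (M₁ zero j * det n (minor M₁ j))) + s * (M₂ zero j * det n (minor M₁ j))
      ≡⟨ cong (λ d → a * expansion M₁ j + s * (M₂ zero j * d))
              (det-cong n λ i k → trans (sym (M≈M₁ (suc i) (λ ()) (punchIn j k))) (M≈M₂ (suc i) (λ ()) (punchIn j k))) ⟩
    a * expansion M₁ j + expansion M₂ j ∎
    where
    s : ℤ
    s = sign (toℕ j)
    distrib : ∀ s a x y d → s * ((a * x + y) * d) ≡ a * (s * (x * d)) + s * (y * d)
    distrib = solve-∀
  term (suc r) M≈M₁ M≈M₂ row-r j = begin
    s * (M zero j * det n (minor M j))
      ≡⟨ cong (λ d → s * (M zero j * d))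
              (det-linear n (minor M j) (minor M₁ j) (minor M₂ j) r a
                 (λ i i≢r k → M≈M₁ (suc i) (i≢r ∘ FinP.suc-injective) (punchIn j k))
                 (λ i i≢r k → M≈M₂ (suc i) (i≢r ∘ FinP.suc-injective) (punchIn j k))
                 (λ k → row-r (punchIn j k))) ⟩
    s * (M zero j * (a * det n (minor M₁ j) + det n (minor M₂ j)))
      ≡⟨ distrib s (M zero j) a (det n (minor M₁ j)) (det n (minor M₂ j)) ⟩
    a * (s * (M zero j * det n (minor M₁ j))) + s * (M zero j * det n (minor M₂ j))
      ≡⟨ cong₂ (λ x y → a * (s * (x * det n (minor M₁ j))) + s * (y * det n (minor M₂ j)))
               (M≈M₁ zero (λ ()) j) (M≈M₂ zero (λ ()) j) ⟩
    a * expansion M₁ j + expansion M₂ j ∎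
    where
    s : ℤ
    s = sign (toℕ j)
    distrib : ∀ s x a d₁ d₂ → s * (x * (a * d₁ + d₂)) ≡ a * (s * (x * d₁)) + s * (x * d₂)
    distrib = solve-∀

-- Alternating multilinear forms

setRow : ∀ {n} → Matrix n → Fin n → (Fin n → ℤ) → Matrix n
setRow M r u i with i FinP.≟ r
... | yes _ = u
... | no  _ = M i

setRow-≡ : ∀ {n} (M : Matrix n) r u j → setRow M r u r j ≡ u j
setRow-≡ M r u j with r FinP.≟ r
... | yes _  = refl
... | no r≢r = ⊥-elim (r≢r refl)

setRow-≢ : ∀ {n} (M : Matrix n) r u i → i ≢ r → ∀ j → setRow M r u i j ≡ M i j
setRow-≢ M r u i i≢r j with i FinP.≟ r
... | yes i≡r = ⊥-elim (i≢r i≡r)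
... | no  _   = refl

setRow-self : ∀ {n} (M : Matrix n) r u → (∀ k → u k ≡ M r k) → ∀ i k → setRow M r u i k ≡ M i k
setRow-self M r u u≡Mr i k with i FinP.≟ r
... | yes refl = u≡Mr k
... | no  _    = refl

swapRows : ∀ {n} → Matrix n → Fin n → Fin n → Matrix n
swapRows M r s = setRow (setRow M s (M r)) r (M s)

swapRows-r : ∀ {n} (M : Matrix n) r s j → swapRows M r s r j ≡ M s j
swapRows-r M r s = setRow-≡ (setRow M s (M r)) r (M s)

swapRows-s : ∀ {n} (M : Matrix n) r s → r ≢ s → ∀ j → swapRows M r s s j ≡ M r j
swapRows-s M r s r≢s j = trans (setRow-≢ (setRow M s (M r)) r (M s) s (r≢s ∘ sym) j) (setRow-≡ M s (M r) j)

swapRows-other : ∀ {n} (M : Matrix n) r s i → i ≢ r → i ≢ s → ∀ j → swapRows M r s i j ≡ M i j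
swapRows-other M r s i i≢r i≢s j = trans (setRow-≢ (setRow M s (M r)) r (M s) i i≢r j) (setRow-≢ M s (M r) i i≢s j)

record IsAlternatingMultilinear {n} (D : Matrix n → ℤ) : Set where
  field
    extensional : ∀ {M N} → (∀ i j → M i j ≡ N i j) → D M ≡ D N
    linear      : ∀ (M M₁ M₂ : Matrix n) r a → RowsAgreeExcept r M M₁ → RowsAgreeExcept r M M₂ →
                  (∀ j → M r j ≡ a * M₁ r j + M₂ r j) → D M ≡ a * D M₁ + D M₂
    alternating : ∀ (M : Matrix n) {r s} → r ≢ s → (∀ j → M r j ≡ M s j) → D M ≡ 0ℤ

module AlternatingMultilinear {n} {D : Matrix n → ℤ} (isAM : IsAlternatingMultilinear D) where
  open IsAlternatingMultilinear isAM

  additive : ∀ (M M₁ M₂ : Matrix n) r → RowsAgreeExcept r M M₁ → RowsAgreeExcept r M M₂ →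
             (∀ j → M r j ≡ M₁ r j + M₂ r j) → D M ≡ D M₁ + D M₂
  additive M M₁ M₂ r M≈M₁ M≈M₂ row-r =
    trans (linear M M₁ M₂ r 1ℤ M≈M₁ M≈M₂ λ j → trans (row-r j) (cong (_+ M₂ r j) (sym (ℤP.*-identityˡ (M₁ r j)))))
          (cong (_+ D M₂) (ℤP.*-identityˡ (D M₁)))

  zero-row : ∀ M r → (∀ j → M r j ≡ 0ℤ) → D M ≡ 0ℤ
  zero-row M r row-r≡0 = +-identityˡ-unique (D M) (D M) (sym (additive M M M r (λ _ _ _ → refl) (λ _ _ _ → refl) row))
    where
    row : ∀ j → M r j ≡ M r j + M r j
    row j rewrite row-r≡0 j = refl

  add-row-multiple : ∀ (M M′ : Matrix n) r s a → r ≢ s → RowsAgreeExcept r M′ M →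
                     (∀ j → M′ r j ≡ M r j + a * M s j) → D M′ ≡ D M
  add-row-multiple M M′ r s a r≢s M′≈M row-r = begin
    D M′                ≡⟨ linear M′ M[r≔s] M r a M′≈M[r≔s] M′≈M row-r′ ⟩
    a * D M[r≔s] + D M  ≡⟨ cong (λ d → a * d + D M) (alternating M[r≔s] r≢s rows-r-s) ⟩
    a * 0ℤ + D M        ≡⟨ cong (_+ D M) (ℤP.*-zeroʳ a) ⟩
    0ℤ + D M            ≡⟨ ℤP.+-identityˡ (D M) ⟩
    D M                 ∎
    where
    M[r≔s] : Matrix n
    M[r≔s] = setRow M r (M s)
    M′≈M[r≔s] : RowsAgreeExcept r M′ M[r≔s]
    M′≈M[r≔s] i i≢r j = trans (M′≈M i i≢r j) (sym (setRow-≢ M r (M s) i i≢r j))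
    row-r′ : ∀ j → M′ r j ≡ a * M[r≔s] r j + M r j
    row-r′ j = trans (row-r j) (trans (ℤP.+-comm (M r j) (a * M s j)) (cong (λ x → a * x + M r j) (sym (setRow-≡ M r (M s) j))))
    rows-r-s : ∀ j → M[r≔s] r j ≡ M[r≔s] s j
    rows-r-s j = trans (setRow-≡ M r (M s) j) (sym (setRow-≢ M r (M s) s (r≢s ∘ sym) j))

  linear-sum : ∀ {t} (M : Matrix n) r (c : Fin t → ℤ) (U : Fin t → Fin n → ℤ) →
               D (setRow M r (λ k → sum (λ i → c i * U i k))) ≡ sum (λ i → c i * D (setRow M r (U i)))
  linear-sum {zero} M r c U = zero-row (setRow M r (λ _ → 0ℤ)) r (setRow-≡ M r (λ _ → 0ℤ))
  linear-sum {suc t} M r c U = begin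
    D (setRow M r (row c U))
      ≡⟨ linear (setRow M r (row c U)) (setRow M r (U zero)) (setRow M r (row (c ∘ suc) (U ∘ suc))) r (c zero)
                (off-r (row c U) (U zero)) (off-r (row c U) (row (c ∘ suc) (U ∘ suc)))
                (λ k → trans (setRow-≡ M r (row c U) k)
                             (sym (cong₂ (λ x y → c zero * x + y) (setRow-≡ M r (U zero) k)
                                                                  (setRow-≡ M r (row (c ∘ suc) (U ∘ suc)) k)))) ⟩
    c zero * D (setRow M r (U zero)) + D (setRow M r (row (c ∘ suc) (U ∘ suc)))
      ≡⟨ cong (c zero * D (setRow M r (U zero)) +_) (linear-sum M r (c ∘ suc) (U ∘ suc)) ⟩
    sum (λ i → c i * D (setRow M r (U i))) ∎
    where
    row : ∀ {t} → (Fin t → ℤ) → (Fin t → Fin n → ℤ) → Fin n → ℤ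
    row c U k = sum (λ i → c i * U i k)
    off-r : ∀ u v → RowsAgreeExcept r (setRow M r u) (setRow M r v)
    off-r u v i i≢r k = trans (setRow-≢ M r u i i≢r k) (sym (setRow-≢ M r v i i≢r k))

  restore-row : ∀ (M M′ : Matrix n) r j x → (∀ k → M r k ≡ δ j k) → (∀ k → M′ r k ≡ M r k) →
                (∀ k → k ≢ j → M′ x k ≡ M x k) → D M′ ≡ D (setRow M′ x (M x))
  restore-row M M′ r j x row-r≡δ M′r≡Mr off-column with x FinP.≟ r
  ... | yes refl = extensional λ i k → sym (setRow-self M′ x (M x) (λ k → sym (M′r≡Mr k)) i k)
  ... | no  x≢r  =
    add-row-multiple (setRow M′ x (M x)) M′ x r a x≢r (λ i i≢x k → sym (setRow-≢ M′ x (M x) i i≢x k)) row-x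
    where
    a : ℤ
    a = M′ x j - M x j

    entry : ∀ k → M′ x k ≡ M x k + a * δ j k
    entry k with k FinP.≟ j
    ... | yes refl = trans (restore (M x k) (M′ x k)) (cong (λ d → M x k + a * d) (sym (δ-refl k)))
      where
      restore : ∀ u v → v ≡ u + (v - u) * 1ℤ
      restore = solve-∀
    ... | no k≢j = trans (off-column k k≢j) (sym (trans (cong (λ d → M x k + a * d) (δ-≢ (k≢j ∘ sym))) (vanish (M x k) a)))
      where
      vanish : ∀ u a → u + a * 0ℤ ≡ u
      vanish = solve-∀

    row-x : ∀ k → M′ x k ≡ setRow M′ x (M x) x k + a * setRow M′ x (M x) r k
    row-x k = trans (entry k) (sym (cong₂ (λ u v → u + a * v) (setRow-≡ M′ x (M x) k)
                                          (trans (setRow-≢ M′ x (M x) r (x≢r ∘ sym) k) (trans (M′r≡Mr k) (row-r≡δ k)))))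

  unit-row-clears-column : ∀ (M M′ : Matrix n) r j → (∀ k → M r k ≡ δ j k) → (∀ k → M′ r k ≡ M r k) →
                           (∀ i k → k ≢ j → M′ i k ≡ M i k) → D M′ ≡ D M
  unit-row-clears-column M M′ r j row-r≡δ M′r≡Mr off-column =
    restore (allFin n) M′ (λ i i∉ → ⊥-elim (i∉ (∈-allFin i))) M′r≡Mr off-column
    where
    restore : ∀ l M′ → (∀ i → i ∉ l → ∀ k → M′ i k ≡ M i k) → (∀ k → M′ r k ≡ M r k) →
              (∀ i k → k ≢ j → M′ i k ≡ M i k) → D M′ ≡ D M
    restore []      M′ agree _ _ = extensional (λ i → agree i (λ ()))
    restore (x ∷ l) M′ agree M′r≡Mr off-column =
      trans (restore-row M M′ r j x row-r≡δ M′r≡Mr (off-column x)) (restore l M″ agree″ M″r≡Mr off-column″)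
      where
      M″ : Matrix n
      M″ = setRow M′ x (M x)

      agree″ : ∀ i → i ∉ l → ∀ k → M″ i k ≡ M i k
      agree″ i i∉l k with i FinP.≟ x
      ... | yes refl = refl
      ... | no i≢x   = agree i (λ { (here i≡x) → i≢x i≡x ; (there i∈l) → i∉l i∈l }) k

      M″r≡Mr : ∀ k → M″ r k ≡ M r k
      M″r≡Mr k with r FinP.≟ x
      ... | yes refl = refl
      ... | no  _    = M′r≡Mr k

      off-column″ : ∀ i k → k ≢ j → M″ i k ≡ M i k
      off-column″ i k k≢j with i FinP.≟ x
      ... | yes refl = refl
      ... | no  _    = off-column i k k≢j

  -- Writing M⟨ x ∣ y ⟩ for M with rows r, s replaced by x, y, bilinearity and alternation give
  -- 0 = M⟨ u+v ∣ u+v ⟩ = M⟨ u ∣ u ⟩ + M⟨ u ∣ v ⟩ + M⟨ v ∣ u ⟩ + M⟨ v ∣ v ⟩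
  --   = M⟨ u ∣ v ⟩ + M⟨ v ∣ u ⟩.
  swap-rows : ∀ (M M′ : Matrix n) r s → r ≢ s → (∀ j → M′ r j ≡ M s j) → (∀ j → M′ s j ≡ M r j) →
              (∀ i → i ≢ r → i ≢ s → ∀ j → M′ i j ≡ M i j) → D M′ ≡ - D M
  swap-rows M M′ r s r≢s row-r row-s others = sym (+-cancelˡ (D M) (- D M) (D M′) (begin
    D M + - D M                  ≡⟨ ℤP.+-inverseʳ (D M) ⟩
    0ℤ                           ≡⟨ sym (with-rows-equal (u+v)) ⟩
    D M⟨ u+v ∣ u+v ⟩              ≡⟨ additive-r u v u+v ⟩
    D M⟨ u ∣ u+v ⟩ + D M⟨ v ∣ u+v ⟩ ≡⟨ cong₂ _+_ (additive-s u u v) (additive-s v u v) ⟩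
    (D M⟨ u ∣ u ⟩ + D M⟨ u ∣ v ⟩) + (D M⟨ v ∣ u ⟩ + D M⟨ v ∣ v ⟩)
      ≡⟨ cong₂ (λ x y → (x + D M⟨ u ∣ v ⟩) + (D M⟨ v ∣ u ⟩ + y)) (with-rows-equal u) (with-rows-equal v) ⟩
    (0ℤ + D M⟨ u ∣ v ⟩) + (D M⟨ v ∣ u ⟩ + 0ℤ)
      ≡⟨ cong₂ _+_ (trans (ℤP.+-identityˡ _) (extensional (is-M)) ) (trans (ℤP.+-identityʳ _) (extensional is-M′)) ⟩
    D M + D M′                   ∎))
    where
    u v : Fin n → ℤ
    u = M r
    v = M s
    u+v : Fin n → ℤ
    u+v j = u j + v j

    M⟨_∣_⟩ : (Fin n → ℤ) → (Fin n → ℤ) → Matrix n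
    M⟨ x ∣ y ⟩ = setRow (setRow M s y) r x

    at-r : ∀ x y j → M⟨ x ∣ y ⟩ r j ≡ x j
    at-r x y j = setRow-≡ (setRow M s y) r x j

    at-s : ∀ x y j → M⟨ x ∣ y ⟩ s j ≡ y j
    at-s x y j = trans (setRow-≢ (setRow M s y) r x s (r≢s ∘ sym) j) (setRow-≡ M s y j)

    off-r : ∀ x x′ y → RowsAgreeExcept r M⟨ x ∣ y ⟩ M⟨ x′ ∣ y ⟩
    off-r x x′ y i i≢r j = trans (setRow-≢ (setRow M s y) r x i i≢r j) (sym (setRow-≢ (setRow M s y) r x′ i i≢r j))

    off-s : ∀ x y y′ → RowsAgreeExcept s M⟨ x ∣ y ⟩ M⟨ x ∣ y′ ⟩
    off-s x y y′ i i≢s j with i FinP.≟ r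
    ... | yes _ = refl
    ... | no  _ = trans (setRow-≢ M s y i i≢s j) (sym (setRow-≢ M s y′ i i≢s j))

    additive-r : ∀ x₁ x₂ y → D M⟨ (λ j → x₁ j + x₂ j) ∣ y ⟩ ≡ D M⟨ x₁ ∣ y ⟩ + D M⟨ x₂ ∣ y ⟩
    additive-r x₁ x₂ y = additive _ _ _ r (off-r _ x₁ y) (off-r _ x₂ y)
      (λ j → trans (at-r _ y j) (sym (cong₂ _+_ (at-r x₁ y j) (at-r x₂ y j))))

    additive-s : ∀ x y₁ y₂ → D M⟨ x ∣ (λ j → y₁ j + y₂ j) ⟩ ≡ D M⟨ x ∣ y₁ ⟩ + D M⟨ x ∣ y₂ ⟩
    additive-s x y₁ y₂ = additive _ _ _ s (off-s x _ y₁) (off-s x _ y₂)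
      (λ j → trans (at-s x _ j) (sym (cong₂ _+_ (at-s x y₁ j) (at-s x y₂ j))))

    with-rows-equal : ∀ x → D M⟨ x ∣ x ⟩ ≡ 0ℤ
    with-rows-equal x = alternating M⟨ x ∣ x ⟩ r≢s (λ j → trans (at-r x x j) (sym (at-s x x j)))

    is-M : ∀ i j → M⟨ u ∣ v ⟩ i j ≡ M i j
    is-M i j with i FinP.≟ r
    ... | yes i≡r = cong (λ k → M k j) (sym i≡r)
    ... | no _ with i FinP.≟ s
    ...   | yes i≡s = cong (λ k → M k j) (sym i≡s)
    ...   | no _    = refl

    is-M′ : ∀ i j → M⟨ v ∣ u ⟩ i j ≡ M′ i j
    is-M′ i j with i FinP.≟ r
    ... | yes refl = sym (row-r j)
    ... | no i≢r with i FinP.≟ s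
    ...   | yes refl = sym (row-s j)
    ...   | no i≢s   = sym (others i i≢r i≢s j)

punchOut-punchIn′ : ∀ {n} (j : Fin (suc n)) (k : Fin n) (j≢ : j ≢ punchIn j k) → punchOut j≢ ≡ k
punchOut-punchIn′ j k j≢ = trans (FinP.punchOut-cong j refl) (FinP.punchOut-punchIn j)

punchIn-punchIn-punchOut : ∀ {n} (j c : Fin (suc (suc n))) (j≢c : j ≢ c) (c≢j : c ≢ j) (k : Fin n) →
                           punchIn c (punchIn (punchOut c≢j) k) ≡ punchIn j (punchIn (punchOut j≢c) k)
punchIn-punchIn-punchOut zero    zero    j≢c _ k = ⊥-elim (j≢c refl)
punchIn-punchIn-punchOut zero    (suc c) _   _ k = refl
punchIn-punchIn-punchOut (suc j) zero    _   _ k = refl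
punchIn-punchIn-punchOut {suc n} (suc j) (suc c) _ _ zero = refl
punchIn-punchIn-punchOut {suc n} (suc j) (suc c) j≢c c≢j (suc k) =
  cong suc (punchIn-punchIn-punchOut j c (j≢c ∘ cong suc) (c≢j ∘ cong suc) k)

sign-punchOut : ∀ {n} (j c : Fin (suc n)) (j≢c : j ≢ c) (c≢j : c ≢ j) →
                sign (toℕ c) * sign (toℕ (punchOut c≢j)) ≡ - (sign (toℕ j) * sign (toℕ (punchOut j≢c)))
sign-punchOut zero zero j≢c _ = ⊥-elim (j≢c refl)
sign-punchOut {suc n} zero (suc c) _ _ = lemma (sign (toℕ c))
  where
  lemma : ∀ x → - x * 1ℤ ≡ - (1ℤ * x)
  lemma = solve-∀
sign-punchOut {suc n} (suc j) zero _ _ = lemma (sign (toℕ j))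
  where
  lemma : ∀ x → 1ℤ * x ≡ - (- x * 1ℤ)
  lemma = solve-∀
sign-punchOut {suc n} (suc j) (suc c) j≢c c≢j =
  trans (neg*neg (sign (toℕ c)) (sign (toℕ (punchOut c≢j′))))
        (trans (sign-punchOut j c j≢c′ c≢j′) (cong -_ (sym (neg*neg (sign (toℕ j)) (sign (toℕ (punchOut j≢c′)))))))
  where
  j≢c′ : j ≢ c
  j≢c′ = j≢c ∘ cong suc
  c≢j′ : c ≢ j
  c≢j′ = c≢j ∘ cong suc
  neg*neg : ∀ x y → - x * - y ≡ x * y
  neg*neg = solve-∀

-- Expanding along rows 0 and 1 writes det M as ∑ T j c over j ≢ c; when these rows agree, T is antisymmetric.
module DoubleExpansion {n} (M : Matrix (suc (suc n))) (row₀≡row₁ : ∀ j → M zero j ≡ M (suc zero) j) where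
  N : ∀ j c → j ≢ c → Matrix n
  N j c j≢c i k = M (suc (suc i)) (punchIn j (punchIn (punchOut j≢c) k))

  T′ : ∀ j c → Dec (j ≡ c) → ℤ
  T′ j c (yes _)  = 0ℤ
  T′ j c (no j≢c) = sign (toℕ j) * sign (toℕ (punchOut j≢c)) * (M zero j * M zero c * det n (N j c j≢c))

  T : Fin (suc (suc n)) → Fin (suc (suc n)) → ℤ
  T j c = T′ j c (j FinP.≟ c)

  T-diagonal : ∀ j (d : Dec (j ≡ j)) → T′ j j d ≡ 0ℤ
  T-diagonal j (yes _)  = refl
  T-diagonal j (no j≢j) = ⊥-elim (j≢j refl)

  T-punchIn : ∀ j k (d : Dec (j ≡ punchIn j k)) →
    T′ j (punchIn j k) d ≡ sign (toℕ j) * (M zero j * (sign (toℕ k) * (M (suc zero) (punchIn j k) * det n (minor (minor M j) k))))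
  T-punchIn j k (yes j≡) = ⊥-elim (FinP.punchInᵢ≢i j k (sym j≡))
  T-punchIn j k (no j≢) = begin
    sign (toℕ j) * sign (toℕ (punchOut j≢)) * (M zero j * M zero (punchIn j k) * det n (N j (punchIn j k) j≢))
      ≡⟨ cong₂ (λ c d → sign (toℕ j) * sign (toℕ c) * (M zero j * M zero (punchIn j k) * d))
               (punchOut-punchIn′ j k j≢)
               (det-cong n λ i l → cong (λ c → M (suc (suc i)) (punchIn j (punchIn c l))) (punchOut-punchIn′ j k j≢)) ⟩
    sign (toℕ j) * sign (toℕ k) * (M zero j * M zero (punchIn j k) * det n (minor (minor M j) k))
      ≡⟨ cong (λ x → sign (toℕ j) * sign (toℕ k) * (M zero j * x * det n (minor (minor M j) k)))
              (row₀≡row₁ (punchIn j k)) ⟩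
    sign (toℕ j) * sign (toℕ k) * (M zero j * M (suc zero) (punchIn j k) * det n (minor (minor M j) k))
      ≡⟨ reassociate (sign (toℕ j)) (sign (toℕ k)) (M zero j) (M (suc zero) (punchIn j k)) (det n (minor (minor M j) k)) ⟩
    sign (toℕ j) * (M zero j * (sign (toℕ k) * (M (suc zero) (punchIn j k) * det n (minor (minor M j) k)))) ∎
    where
    reassociate : ∀ s t x y d → s * t * (x * y * d) ≡ s * (x * (t * (y * d)))
    reassociate = solve-∀

  expansion≡∑T : ∀ j → sign (toℕ j) * (M zero j * det (suc n) (minor M j)) ≡ sum (T j)
  expansion≡∑T j = begin
    sign (toℕ j) * (M zero j * sum minor-term)
      ≡⟨ cong (sign (toℕ j) *_) (*-distribˡ-sum (M zero j) minor-term) ⟩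
    sign (toℕ j) * sum (λ k → M zero j * minor-term k)
      ≡⟨ *-distribˡ-sum (sign (toℕ j)) (λ k → M zero j * minor-term k) ⟩
    sum (λ k → sign (toℕ j) * (M zero j * minor-term k))
      ≡⟨ sum-cong-≗ (λ k → sym (T-punchIn j k (j FinP.≟ punchIn j k))) ⟩
    sum (λ k → T j (punchIn j k))
      ≡⟨ sym (trans (cong (_+ sum (λ k → T j (punchIn j k))) (T-diagonal j (j FinP.≟ j))) (ℤP.+-identityˡ _)) ⟩
    T j j + sum (λ k → T j (punchIn j k))
      ≡⟨ sym (sum-remove {i = j} (T j)) ⟩
    sum (T j) ∎
    where
    minor-term : Fin (suc n) → ℤ
    minor-term k = sign (toℕ k) * (M (suc zero) (punchIn j k) * det n (minor (minor M j) k))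

  T-antisymmetric : ∀ j c (d₁ : Dec (c ≡ j)) (d₂ : Dec (j ≡ c)) → T′ c j d₁ ≡ - T′ j c d₂
  T-antisymmetric j c (yes _)   (yes _)   = refl
  T-antisymmetric j c (yes c≡j) (no j≢c)  = ⊥-elim (j≢c (sym c≡j))
  T-antisymmetric j c (no c≢j)  (yes j≡c) = ⊥-elim (c≢j (sym j≡c))
  T-antisymmetric j c (no c≢j)  (no j≢c)  = begin
    sign (toℕ c) * sign (toℕ (punchOut c≢j)) * (M zero c * M zero j * det n (N c j c≢j))
      ≡⟨ cong₂ (λ s x → s * x) (sign-punchOut j c j≢c c≢j)
               (cong₂ _*_ (ℤP.*-comm (M zero c) (M zero j))
                          (det-cong n λ i k → cong (M (suc (suc i))) (punchIn-punchIn-punchOut j c j≢c c≢j k))) ⟩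
    - (sign (toℕ j) * sign (toℕ (punchOut j≢c))) * (M zero j * M zero c * det n (N j c j≢c))
      ≡⟨ ℤP.neg-distribˡ-* (sign (toℕ j) * sign (toℕ (punchOut j≢c))) (M zero j * M zero c * det n (N j c j≢c)) ⟨
    - (sign (toℕ j) * sign (toℕ (punchOut j≢c)) * (M zero j * M zero c * det n (N j c j≢c))) ∎

  ∑∑T≡0 : sum (λ j → sum (T j)) ≡ 0ℤ
  ∑∑T≡0 = x≡-x⇒x≡0 _ (begin
    sum (λ j → sum (T j))         ≡⟨ ∑-comm T ⟩
    sum (λ c → sum (λ j → T j c))
      ≡⟨ sum-cong-≗ (λ c → sum-cong-≗ (λ j → T-antisymmetric c j (j FinP.≟ c) (c FinP.≟ j))) ⟩
    sum (λ c → sum (λ j → - T c j)) ≡⟨ sum-cong-≗ (λ c → neg-distrib-sum (T c)) ⟨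
    sum (λ c → - sum (T c))       ≡⟨ neg-distrib-sum (λ c → sum (T c)) ⟨
    - sum (λ j → sum (T j))       ∎)

det-rows-0-1-equal : ∀ n (M : Matrix (suc (suc n))) → (∀ j → M zero j ≡ M (suc zero) j) → det (suc (suc n)) M ≡ 0ℤ
det-rows-0-1-equal n M row₀≡row₁ = trans (sum-cong-≗ expansion≡∑T) ∑∑T≡0
  where open DoubleExpansion M row₀≡row₁

mutual
  det-isAlternatingMultilinear : ∀ n → IsAlternatingMultilinear (det n)
  det-isAlternatingMultilinear n = record
    { extensional = det-cong n ; linear = det-linear n ; alternating = det-alternating n }

  det-alternating : ∀ n (M : Matrix n) {r s} → r ≢ s → (∀ j → M r j ≡ M s j) → det n M ≡ 0ℤ
  det-alternating (suc n) M {zero}  {zero}  0≢0 _  = ⊥-elim (0≢0 refl)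
  det-alternating (suc n) M {zero}  {suc s} _   eq = det-row-0-equal n (det-isAlternatingMultilinear n) M s eq
  det-alternating (suc n) M {suc r} {zero}  _   eq = det-row-0-equal n (det-isAlternatingMultilinear n) M r (sym ∘ eq)
  det-alternating (suc n) M {suc r} {suc s} r≢s eq = sum-zero _ λ j →
    trans (cong (λ d → sign (toℕ j) * (M zero j * d))
                (det-alternating n (minor M j) (r≢s ∘ cong suc) (λ k → eq (punchIn j k))))
          (annihilate (sign (toℕ j)) (M zero j))
    where
    annihilate : ∀ s x → s * (x * 0ℤ) ≡ 0ℤ
    annihilate = solve-∀

  -- For s ≥ 1, swapping rows 1 and s + 1 negates every minor along row 0 and yields rows 0 and 1 equal.
  det-row-0-equal : ∀ n → IsAlternatingMultilinear (det n) →
                    ∀ (M : Matrix (suc n)) s → (∀ j → M zero j ≡ M (suc s) j) → det (suc n) M ≡ 0ℤ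
  det-row-0-equal (suc n) _ M zero eq = det-rows-0-1-equal n M eq
  det-row-0-equal (suc (suc n)) det-isAM M (suc s) eq = begin
    det (3+n) M    ≡⟨ ℤP.neg-involutive _ ⟨
    - - det (3+n) M ≡⟨ cong -_ det-M′≡-det-M ⟨
    - det (3+n) M′ ≡⟨ cong -_ (det-rows-0-1-equal (suc n) M′ (λ j → trans (M′-0 j) (trans (eq j) (sym (M′-1 j))))) ⟩
    - 0ℤ           ∎
    where
    3+n : ℕ
    3+n = suc (suc (suc n))
    M′ : Matrix 3+n
    M′ = swapRows M (suc zero) (suc (suc s))

    M′-0 : ∀ j → M′ zero j ≡ M zero j
    M′-0 = swapRows-other M (suc zero) (suc (suc s)) zero (λ ()) (λ ())

    M′-1 : ∀ j → M′ (suc zero) j ≡ M (suc (suc s)) j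
    M′-1 = swapRows-r M (suc zero) (suc (suc s))

    M′-s : ∀ j → M′ (suc (suc s)) j ≡ M (suc zero) j
    M′-s = swapRows-s M (suc zero) (suc (suc s)) (λ ())

    minor-swapped : ∀ j → det (suc (suc n)) (minor M′ j) ≡ - det (suc (suc n)) (minor M j)
    minor-swapped j = AlternatingMultilinear.swap-rows det-isAM
      (minor M j) (minor M′ j) zero (suc s) (λ ())
      (λ k → M′-1 (punchIn j k)) (λ k → M′-s (punchIn j k))
      (λ i i≢0 i≢s k → swapRows-other M (suc zero) (suc (suc s)) (suc i)
                         (i≢0 ∘ FinP.suc-injective) (i≢s ∘ FinP.suc-injective) (punchIn j k))

    det-M′≡-det-M : det 3+n M′ ≡ - det 3+n M
    det-M′≡-det-M = begin
      sum (λ j → sign (toℕ j) * (M′ zero j * det (suc (suc n)) (minor M′ j)))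
        ≡⟨ sum-cong-≗ (λ j → trans (cong₂ (λ x d → sign (toℕ j) * (x * d)) (M′-0 j) (minor-swapped j))
                                   (negate (sign (toℕ j)) (M zero j) _)) ⟩
      sum (λ j → - (sign (toℕ j) * (M zero j * det (suc (suc n)) (minor M j))))
        ≡⟨ neg-distrib-sum (λ j → sign (toℕ j) * (M zero j * det (suc (suc n)) (minor M j))) ⟨
      - det 3+n M ∎
      where
      negate : ∀ s x d → s * (x * - d) ≡ - (s * (x * d))
      negate = solve-∀

-- Uniqueness of the determinant and its consequences

insertZeroAt : ∀ {n} → Fin (suc n) → (Fin n → ℤ) → Fin (suc n) → ℤ
insertZeroAt j y k with j FinP.≟ k
... | yes _   = 0ℤ
... | no  j≢k = y (punchOut j≢k)

insertZeroAt-cong : ∀ {n} j {y y′ : Fin n → ℤ} → (∀ k → y k ≡ y′ k) →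
                    ∀ k → insertZeroAt j y k ≡ insertZeroAt j y′ k
insertZeroAt-cong j y≗y′ k with j FinP.≟ k
... | yes _   = refl
... | no  j≢k = y≗y′ (punchOut j≢k)

insertZeroAt-linear : ∀ {n} j {y y₁ y₂ : Fin n → ℤ} a → (∀ k → y k ≡ a * y₁ k + y₂ k) →
                      ∀ k → insertZeroAt j y k ≡ a * insertZeroAt j y₁ k + insertZeroAt j y₂ k
insertZeroAt-linear j a y≡ k with j FinP.≟ k
... | yes _   = sym (cong (_+ 0ℤ) (ℤP.*-zeroʳ a))
... | no  j≢k = y≡ (punchOut j≢k)

insertZeroAt-δ : ∀ {n} j (i : Fin n) k → insertZeroAt j (δ i) k ≡ δ (punchIn j i) k
insertZeroAt-δ j i k with j FinP.≟ k
... | yes refl = sym (δ-≢ (FinP.punchInᵢ≢i j i))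
... | no  j≢k  = trans (sym (δ-injective (punchIn j) (FinP.punchIn-injective j _ _) i (punchOut j≢k)))
                       (cong (δ (punchIn j i)) (FinP.punchIn-punchOut j≢k))

insertZeroAt-punchOut : ∀ {n} j (y : Fin (suc n) → ℤ) k → k ≢ j → insertZeroAt j (y ∘ punchIn j) k ≡ y k
insertZeroAt-punchOut j y k k≢j with j FinP.≟ k
... | yes j≡k = ⊥-elim (k≢j (sym j≡k))
... | no  j≢k = cong y (FinP.punchIn-punchOut j≢k)

border : ∀ {n} → Fin (suc n) → Matrix n → Matrix (suc n)
border j Y zero    = δ j
border j Y (suc i) = insertZeroAt j (Y i)

border-isAlternatingMultilinear : ∀ {n} {D : Matrix (suc n) → ℤ} j →
  IsAlternatingMultilinear D → IsAlternatingMultilinear (λ Y → D (border j Y))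
border-isAlternatingMultilinear {n} {D} j isAM = record
  { extensional = λ Y≗Y′ → extensional (λ { zero k → refl ; (suc i) k → insertZeroAt-cong j (Y≗Y′ i) k })
  ; linear      = λ Y Y₁ Y₂ r a Y≈Y₁ Y≈Y₂ row-r →
      linear (border j Y) (border j Y₁) (border j Y₂) (suc r) a (agree Y≈Y₁) (agree Y≈Y₂) (insertZeroAt-linear j a row-r)
  ; alternating = λ Y r≢s eq → alternating (border j Y) (r≢s ∘ FinP.suc-injective) (insertZeroAt-cong j eq)
  }
  where
  open IsAlternatingMultilinear isAM
  agree : ∀ {r} {Y Y′ : Matrix n} → RowsAgreeExcept r Y Y′ → RowsAgreeExcept (suc r) (border j Y) (border j Y′)
  agree Y≈Y′ zero    _     k = refl
  agree Y≈Y′ (suc i) i≢r k = insertZeroAt-cong j (Y≈Y′ i (i≢r ∘ cong suc)) k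

punchIn-inject₁-self : ∀ {n} (i : Fin n) → punchIn (inject₁ i) i ≡ suc i
punchIn-inject₁-self zero    = refl
punchIn-inject₁-self (suc i) = cong suc (punchIn-inject₁-self i)

punchIn-suc-self : ∀ {n} (i : Fin n) → punchIn (suc i) i ≡ inject₁ i
punchIn-suc-self zero    = refl
punchIn-suc-self (suc i) = cong suc (punchIn-suc-self i)

punchIn-suc-inject₁ : ∀ {n} (i j : Fin n) → i ≢ j → punchIn (suc j) i ≡ punchIn (inject₁ j) i
punchIn-suc-inject₁ zero    zero    i≢j = ⊥-elim (i≢j refl)
punchIn-suc-inject₁ zero    (suc j) _   = refl
punchIn-suc-inject₁ (suc i) zero    _   = refl
punchIn-suc-inject₁ (suc i) (suc j) i≢j = cong suc (punchIn-suc-inject₁ i j (i≢j ∘ cong suc))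

-- border (suc j) δ is border (inject₁ j) δ with rows 0 and suc j swapped.
border-δ : ∀ {n} {D : Matrix (suc n) → ℤ} → IsAlternatingMultilinear D →
           ∀ j → D (border j δ) ≡ sign (toℕ j) * D δ
border-δ {n} {D} isAM j = go (toℕ j) j refl
  where
  open IsAlternatingMultilinear isAM
  open AlternatingMultilinear isAM

  go : ∀ t j → toℕ j ≡ t → D (border j δ) ≡ sign t * D δ
  go zero zero _ = trans (extensional is-δ) (sym (ℤP.*-identityˡ _))
    where
    is-δ : ∀ i k → border zero δ i k ≡ δ i k
    is-δ zero    k = refl
    is-δ (suc i) k = insertZeroAt-δ zero i k
  go (suc t) (suc j) t≡ = begin
    D (border (suc j) δ)        ≡⟨ swap-rows (border (inject₁ j) δ) (border (suc j) δ) zero (suc j) (λ ()) row-0 row-j other ⟩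
    - D (border (inject₁ j) δ)  ≡⟨ cong -_ (go t (inject₁ j) (trans (FinP.toℕ-inject₁ j) (ℕP.suc-injective t≡))) ⟩
    - (sign t * D δ)            ≡⟨ ℤP.neg-distribˡ-* (sign t) (D δ) ⟩
    sign (suc t) * D δ          ∎
    where
    row-0 : ∀ k → border (suc j) δ zero k ≡ border (inject₁ j) δ (suc j) k
    row-0 k = sym (trans (insertZeroAt-δ (inject₁ j) j k) (cong (λ c → δ c k) (punchIn-inject₁-self j)))
    row-j : ∀ k → border (suc j) δ (suc j) k ≡ border (inject₁ j) δ zero k
    row-j k = trans (insertZeroAt-δ (suc j) j k) (cong (λ c → δ c k) (punchIn-suc-self j))
    other : ∀ i → i ≢ zero → i ≢ suc j → ∀ k → border (suc j) δ i k ≡ border (inject₁ j) δ i k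
    other zero    i≢0 _   k = ⊥-elim (i≢0 refl)
    other (suc i) _   i≢j k = trans (insertZeroAt-δ (suc j) i k)
      (trans (cong (λ c → δ c k) (punchIn-suc-inject₁ i j (i≢j ∘ cong suc))) (sym (insertZeroAt-δ (inject₁ j) i k)))

-- Expand row 0 in unit vectors; with row 0 equal to δ j the column j can be cleared, leaving border j (minor M j).
uniqueness : ∀ n {D : Matrix n → ℤ} → IsAlternatingMultilinear D → ∀ M → D M ≡ det n M * D δ
uniqueness zero    isAM M = trans (IsAlternatingMultilinear.extensional isAM (λ ())) (sym (ℤP.*-identityˡ _))
uniqueness (suc n) {D} isAM M = begin
  D M
    ≡⟨ extensional row-0-expanded ⟩
  D (setRow M zero (λ k → sum (λ j → M zero j * δ j k)))
    ≡⟨ linear-sum M zero (M zero) δ ⟩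
  sum (λ j → M zero j * D (setRow M zero (δ j)))
    ≡⟨ sum-cong-≗ (λ j → cong (M zero j *_) (cleared j)) ⟨
  sum (λ j → M zero j * D (border j (minor M j)))
    ≡⟨ sum-cong-≗ (λ j → cong (M zero j *_) (uniqueness n (border-isAlternatingMultilinear j isAM) (minor M j))) ⟩
  sum (λ j → M zero j * (det n (minor M j) * D (border j δ)))
    ≡⟨ sum-cong-≗ (λ j → cong (λ d → M zero j * (det n (minor M j) * d)) (border-δ isAM j)) ⟩
  sum (λ j → M zero j * (det n (minor M j) * (sign (toℕ j) * D δ)))
    ≡⟨ sum-cong-≗ (λ j → reassociate (M zero j) (det n (minor M j)) (sign (toℕ j)) (D δ)) ⟩
  sum (λ j → sign (toℕ j) * (M zero j * det n (minor M j)) * D δ)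
    ≡⟨ *-distribʳ-sum (D δ) (λ j → sign (toℕ j) * (M zero j * det n (minor M j))) ⟨
  det (suc n) M * D δ ∎
  where
  open AlternatingMultilinear isAM
  open IsAlternatingMultilinear isAM

  reassociate : ∀ x d s y → x * (d * (s * y)) ≡ s * (x * d) * y
  reassociate = solve-∀

  row-0-expanded : ∀ i k → M i k ≡ setRow M zero (λ k → sum (λ j → M zero j * δ j k)) i k
  row-0-expanded zero    k = sym (trans (setRow-≡ M zero (λ k → sum (λ j → M zero j * δ j k)) k) (sum-δʳ k (M zero)))
  row-0-expanded (suc i) k = sym (setRow-≢ M zero (λ k → sum (λ j → M zero j * δ j k)) (suc i) (λ ()) k)

  cleared : ∀ j → D (border j (minor M j)) ≡ D (setRow M zero (δ j))
  cleared j = unit-row-clears-column (setRow M zero (δ j)) (border j (minor M j)) zero j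
    (setRow-≡ M zero (δ j)) (λ k → sym (setRow-≡ M zero (δ j) k)) off-column
    where
    off-column : ∀ i k → k ≢ j → border j (minor M j) i k ≡ setRow M zero (δ j) i k
    off-column zero    k _   = sym (setRow-≡ M zero (δ j) k)
    off-column (suc i) k k≢j = trans (insertZeroAt-punchOut j (M (suc i)) k k≢j) (sym (setRow-≢ M zero (δ j) (suc i) (λ ()) k))

infixl 7 _*ₘ_
_*ₘ_ : ∀ {n} → Matrix n → Matrix n → Matrix n
(X *ₘ Y) i k = sum (λ c → X i c * Y c k)

δ-*ₘ : ∀ {n} (Y : Matrix n) i k → (δ *ₘ Y) i k ≡ Y i k
δ-*ₘ Y i k = sum-δˡ i (λ c → Y c k)

*ₘ-isAlternatingMultilinear : ∀ n (Y : Matrix n) → IsAlternatingMultilinear (λ X → det n (X *ₘ Y))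
*ₘ-isAlternatingMultilinear n Y = record
  { extensional = λ X≗X′ → det-cong n (λ i k → sum-cong-≗ (λ c → cong (_* Y c k) (X≗X′ i c)))
  ; linear      = λ X X₁ X₂ r a X≈X₁ X≈X₂ row-r → det-linear n (X *ₘ Y) (X₁ *ₘ Y) (X₂ *ₘ Y) r a
      (λ i i≢r k → sum-cong-≗ (λ c → cong (_* Y c k) (X≈X₁ i i≢r c)))
      (λ i i≢r k → sum-cong-≗ (λ c → cong (_* Y c k) (X≈X₂ i i≢r c)))
      (λ k → trans (sum-cong-≗ (λ c → trans (cong (_* Y c k) (row-r c)) (distrib a (X₁ r c) (X₂ r c) (Y c k))))
                   (sum-linear a (λ c → X₁ r c * Y c k) (λ c → X₂ r c * Y c k)))
  ; alternating = λ X r≢s eq → det-alternating n (X *ₘ Y) r≢s (λ k → sum-cong-≗ (λ c → cong (_* Y c k) (eq c)))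
  }
  where
  distrib : ∀ a x₁ x₂ y → (a * x₁ + x₂) * y ≡ a * (x₁ * y) + x₂ * y
  distrib = solve-∀

det-δ : ∀ n → det n δ ≡ 1ℤ
det-δ zero    = refl
det-δ (suc n) = cong₂ _+_ (trans (ℤP.*-identityˡ _) (trans (ℤP.*-identityˡ _) (det-δ n)))
                          (sum-zero _ (λ j → annihilate (sign (suc (toℕ j))) (det n (minor (δ {suc n}) (suc j)))))
  where
  annihilate : ∀ s d → s * (0ℤ * d) ≡ 0ℤ
  annihilate = solve-∀

det-*ₘ : ∀ n (X Y : Matrix n) → det n (X *ₘ Y) ≡ det n X * det n Y
det-*ₘ n X Y = trans (uniqueness n (*ₘ-isAlternatingMultilinear n Y) X) (cong (det n X *_) (det-cong n (δ-*ₘ Y)))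

-- Conjugation by the permutation matrix P of σ, since det P * det Pᵀ = det (P Pᵀ) = 1.
det-reindex : ∀ n (σ : Fin n → Fin n) → Injective _≡_ _≡_ σ → ∀ (A : Matrix n) →
              det n (λ a b → A (σ a) (σ b)) ≡ det n A
det-reindex n σ σ-inj A = begin
  det n (λ a b → A (σ a) (σ b))     ≡⟨ det-cong n reindexed ⟩
  det n (P *ₘ A *ₘ Pᵀ)               ≡⟨ det-*ₘ n (P *ₘ A) Pᵀ ⟩
  det n (P *ₘ A) * det n Pᵀ          ≡⟨ cong (_* det n Pᵀ) (det-*ₘ n P A) ⟩
  det n P * det n A * det n Pᵀ       ≡⟨ regroup (det n P) (det n A) (det n Pᵀ) ⟩
  det n A * (det n P * det n Pᵀ)     ≡⟨ cong (det n A *_) (det-*ₘ n P Pᵀ) ⟨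
  det n A * det n (P *ₘ Pᵀ)          ≡⟨ cong (det n A *_) (trans (det-cong n PPᵀ≡δ) (det-δ n)) ⟩
  det n A * 1ℤ                       ≡⟨ ℤP.*-identityʳ _ ⟩
  det n A                            ∎
  where
  P Pᵀ : Matrix n
  P a c  = δ (σ a) c
  Pᵀ c b = δ c (σ b)
  regroup : ∀ p a q → p * a * q ≡ a * (p * q)
  regroup = solve-∀
  reindexed : ∀ a b → A (σ a) (σ b) ≡ (P *ₘ A *ₘ Pᵀ) a b
  reindexed a b = sym (trans (sum-δʳ (σ b) (λ c → (P *ₘ A) a c)) (sum-δˡ (σ a) (λ c → A c (σ b))))
  PPᵀ≡δ : ∀ a b → (P *ₘ Pᵀ) a b ≡ δ a b
  PPᵀ≡δ a b = trans (sum-δˡ (σ a) (λ c → δ c (σ b))) (δ-injective σ σ-inj a b)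

det-scale : ∀ n c (M : Matrix n) → det n (λ i j → c * M i j) ≡ c ^ n * det n M
det-scale zero    c M = refl
det-scale (suc n) c M = begin
  sum (λ j → sign (toℕ j) * (c * M zero j * det n (λ i k → c * minor M j i k)))
    ≡⟨ sum-cong-≗ (λ j → cong (λ d → sign (toℕ j) * (c * M zero j * d)) (det-scale n c (minor M j))) ⟩
  sum (λ j → sign (toℕ j) * (c * M zero j * (c ^ n * det n (minor M j))))
    ≡⟨ sum-cong-≗ (λ j → regroup (sign (toℕ j)) c (M zero j) (c ^ n) (det n (minor M j))) ⟩
  sum (λ j → c * c ^ n * (sign (toℕ j) * (M zero j * det n (minor M j))))
    ≡⟨ *-distribˡ-sum (c * c ^ n) (λ j → sign (toℕ j) * (M zero j * det n (minor M j))) ⟨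
  c * c ^ n * det (suc n) M ∎
  where
  regroup : ∀ s c m p d → s * (c * m * (p * d)) ≡ c * p * (s * (m * d))
  regroup = solve-∀

moveToFront : ∀ {n} → Fin (suc n) → Fin (suc n) → Fin (suc n)
moveToFront a zero    = a
moveToFront a (suc i) = punchIn a i

moveToFront-injective : ∀ {n} (a : Fin (suc n)) → Injective _≡_ _≡_ (moveToFront a)
moveToFront-injective a {zero}  {zero}  _  = refl
moveToFront-injective a {zero}  {suc y} eq = ⊥-elim (FinP.punchInᵢ≢i a y (sym eq))
moveToFront-injective a {suc x} {zero}  eq = ⊥-elim (FinP.punchInᵢ≢i a x eq)
moveToFront-injective a {suc x} {suc y} eq = cong suc (FinP.punchIn-injective a x y eq)

det-scaled-unit-row : ∀ n (F : Matrix (suc n)) a x → (∀ b → F a b ≡ x * δ a b) →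
                      det (suc n) F ≡ x * det n (λ i j → F (punchIn a i) (punchIn a j))
det-scaled-unit-row n F a x row-a = begin
  det (suc n) F                                     ≡⟨ det-reindex (suc n) (moveToFront a) (moveToFront-injective a) F ⟨
  det (suc n) G                                     ≡⟨ cong₂ _+_ first-term (sum-zero _ other-terms) ⟩
  x * det n (λ i j → F (punchIn a i) (punchIn a j)) + 0ℤ ≡⟨ ℤP.+-identityʳ _ ⟩
  x * det n (λ i j → F (punchIn a i) (punchIn a j)) ∎
  where
  G : Matrix (suc n)
  G i j = F (moveToFront a i) (moveToFront a j)
  first-term : 1ℤ * (G zero zero * det n (minor G zero)) ≡ x * det n (λ i j → F (punchIn a i) (punchIn a j))
  first-term = trans (ℤP.*-identityˡ _)
    (cong (_* det n (minor G zero)) (trans (row-a a) (trans (cong (x *_) (δ-refl a)) (ℤP.*-identityʳ x))))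
  annihilate : ∀ s d → s * (0ℤ * d) ≡ 0ℤ
  annihilate = solve-∀
  other-terms : ∀ j → sign (toℕ (suc j)) * (G zero (suc j) * det n (minor G (suc j))) ≡ 0ℤ
  other-terms j = trans (cong (λ g → sign (toℕ (suc j)) * (g * det n (minor G (suc j))))
                              (trans (row-a (punchIn a j))
                                     (trans (cong (x *_) (δ-≢ (FinP.punchInᵢ≢i a j ∘ sym))) (ℤP.*-zeroʳ x))))
                        (annihilate (sign (toℕ (suc j))) (det n (minor G (suc j))))

-- Peel off, one at a time, rows outside the image of ι; when none is left, ι is a bijection.
det-restrict : ∀ n k (ι : Fin k → Fin n) → Injective _≡_ _≡_ ι → ∀ x (F : Matrix n) →
               (∀ a → (∀ q → ι q ≢ a) → ∀ b → F a b ≡ x * δ a b) →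
               det n F ≡ x ^ (n ∸ k) * det k (λ q q′ → F (ι q) (ι q′))
det-restrict n k ι ι-inj x F outside with FinP.any? (λ a → ¬? (FinP.any? (λ q → ι q FinP.≟ a)))
det-restrict (suc n) k ι ι-inj x F outside | yes (a , a∉ι) = begin
  det (suc n) F
    ≡⟨ det-scaled-unit-row n F a x (outside a (λ q ιq≡a → a∉ι (q , ιq≡a))) ⟩
  x * det n F′
    ≡⟨ cong (x *_) (det-restrict n k ι′ ι′-inj x F′ outside′) ⟩
  x * (x ^ (n ∸ k) * det k (λ q q′ → F′ (ι′ q) (ι′ q′)))
    ≡⟨ cong (λ d → x * (x ^ (n ∸ k) * d))
            (det-cong k λ q q′ → cong₂ F (FinP.punchIn-punchOut (a≢ι q)) (FinP.punchIn-punchOut (a≢ι q′))) ⟩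
  x * (x ^ (n ∸ k) * det k (λ q q′ → F (ι q) (ι q′)))
    ≡⟨ ℤP.*-assoc x _ _ ⟨
  x ^ suc (n ∸ k) * det k (λ q q′ → F (ι q) (ι q′))
    ≡⟨ cong (λ e → x ^ e * det k (λ q q′ → F (ι q) (ι q′))) (ℕP.+-∸-assoc 1 k≤n) ⟨
  x ^ (suc n ∸ k) * det k (λ q q′ → F (ι q) (ι q′)) ∎
  where
  F′ : Matrix n
  F′ i j = F (punchIn a i) (punchIn a j)
  a≢ι : ∀ q → a ≢ ι q
  a≢ι q a≡ιq = a∉ι (q , sym a≡ιq)
  ι′ : Fin k → Fin n
  ι′ q = punchOut (a≢ι q)
  ι′-inj : Injective _≡_ _≡_ ι′
  ι′-inj {q} {q′} eq = ι-inj (FinP.punchOut-injective (a≢ι q) (a≢ι q′) eq)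
  k≤n : k ℕ.≤ n
  k≤n = FinP.injective⇒≤ ι′-inj
  outside′ : ∀ a′ → (∀ q → ι′ q ≢ a′) → ∀ b → F′ a′ b ≡ x * δ a′ b
  outside′ a′ a′∉ι′ b = trans (outside (punchIn a a′) a′∉ι (punchIn a b))
                              (cong (x *_) (δ-injective (punchIn a) (FinP.punchIn-injective a _ _) a′ b))
    where
    a′∉ι : ∀ q → ι q ≢ punchIn a a′
    a′∉ι q eq = a′∉ι′ q (trans (FinP.punchOut-cong a eq) (FinP.punchOut-punchIn a))
det-restrict n k ι ι-inj x F outside | no ι-onto =
  bijective (ℕP.≤-antisym (FinP.injective⇒≤ ι-inj) (FinP.injective⇒≤ preimage-inj)) ι ι-inj
  where
  preimage : ∀ a → ∃ λ q → ι q ≡ a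
  preimage a = decidable-stable (FinP.any? (λ q → ι q FinP.≟ a)) (λ ∄q → ι-onto (a , ∄q))
  preimage-inj : Injective _≡_ _≡_ (proj₁ ∘ preimage)
  preimage-inj {a} {b} eq = trans (sym (proj₂ (preimage a))) (trans (cong ι eq) (proj₂ (preimage b)))
  bijective : ∀ {k} → k ≡ n → (ι : Fin k → Fin n) → Injective _≡_ _≡_ ι →
              det n F ≡ x ^ (n ∸ k) * det k (λ q q′ → F (ι q) (ι q′))
  bijective refl ι ι-inj = begin
    det n F
      ≡⟨ det-reindex n ι ι-inj F ⟨
    det n (λ q q′ → F (ι q) (ι q′))
      ≡⟨ ℤP.*-identityˡ _ ⟨
    1ℤ * det n (λ q q′ → F (ι q) (ι q′))
      ≡⟨ cong (λ e → x ^ e * det n (λ q q′ → F (ι q) (ι q′))) (ℕP.n∸n≡0 n) ⟨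
    x ^ (n ∸ n) * det n (λ q q′ → F (ι q) (ι q′)) ∎

-- The determinant of a blow-up

fibreSize : ∀ {n k} → (Fin n → Fin k) → Fin k → ℤ
fibreSize φ q = sum (λ c → δ (φ c) q)

fibreSize-nonzero : ∀ {n k} (φ : Fin n → Fin k) → Surj φ → ∀ q → fibreSize φ q ≢ 0ℤ
fibreSize-nonzero φ surj q =
  sum-natural-nonzero (λ c → δ (φ c) q) (proj₁ (surj q))
    (trans (cong (λ p → δ p q) (proj₂ (surj q))) (δ-refl q)) (λ c → δ-natural (φ c) q)

sum-over-fibres : ∀ {n k} (φ : Fin n → Fin k) m → (∀ q → fibreSize φ q ≡ m) →
                  ∀ (G : Fin k → ℤ) → sum (λ a → G (φ a)) ≡ m * sum G
sum-over-fibres φ m fibres G = begin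
  sum (λ a → G (φ a))
    ≡⟨ sum-cong-≗ (λ a → sum-δˡ (φ a) G) ⟨
  sum (λ a → sum (λ q → δ (φ a) q * G q))
    ≡⟨ ∑-comm (λ a q → δ (φ a) q * G q) ⟩
  sum (λ q → sum (λ a → δ (φ a) q * G q))
    ≡⟨ sum-cong-≗ (λ q → trans (sum-cong-≗ (λ a → ℤP.*-comm (δ (φ a) q) (G q)))
                               (sym (*-distribˡ-sum (G q) (λ a → δ (φ a) q)))) ⟩
  sum (λ q → G q * fibreSize φ q)
    ≡⟨ sum-cong-≗ (λ q → trans (cong (G q *_) (fibres q)) (ℤP.*-comm (G q) m)) ⟩
  sum (λ q → m * G q)
    ≡⟨ *-distribˡ-sum m G ⟨
  m * sum G ∎

-- The matrix of the blow-up is conjugated by V = I - N, with V⁻¹ = I + N, where N sends every point outside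
-- the image of r to the representative r (φ a) of its fibre; this clears all rows outside that image.
module BlowUp {n k} (φ : Fin n → Fin k) (r : Fin k → Fin n) (φ∘r : ∀ q → φ (r q) ≡ q) where

  r-injective : Injective _≡_ _≡_ r
  r-injective {q} {q′} eq = trans (sym (φ∘r q)) (trans (cong φ eq) (φ∘r q′))

  ρ : Fin n → Fin n
  ρ a = r (φ a)

  φ∘ρ : ∀ a → φ (ρ a) ≡ φ a
  φ∘ρ a = φ∘r (φ a)

  ρ∘ρ : ∀ a → ρ (ρ a) ≡ ρ a
  ρ∘ρ a = cong r (φ∘ρ a)

  isRep nonRep : Fin n → ℤ
  isRep a  = δ a (ρ a)
  nonRep a = 1ℤ - isRep a

  nonRep∘ρ : ∀ a → nonRep (ρ a) ≡ 0ℤ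
  nonRep∘ρ a = trans (cong (λ b → 1ℤ - δ (ρ a) b) (ρ∘ρ a)) (cong (λ d → 1ℤ - d) (δ-refl (ρ a)))

  V W : Matrix n
  V a c = δ a c + (- nonRep a) * δ (ρ a) c
  W a c = δ a c + nonRep a * δ (ρ a) c

  V*W≡δ : ∀ a b → (V *ₘ W) a b ≡ δ a b
  V*W≡δ a b = begin
    sum (λ c → V a c * W c b)   ≡⟨ sum-δ-pair a (ρ a) (- nonRep a) (λ c → W c b) ⟩
    W a b + (- nonRep a) * (δ (ρ a) b + nonRep (ρ a) * δ (ρ (ρ a)) b)
      ≡⟨ cong (λ t → W a b + (- nonRep a) * (δ (ρ a) b + t * δ (ρ (ρ a)) b)) (nonRep∘ρ a) ⟩
    δ a b + nonRep a * δ (ρ a) b + (- nonRep a) * (δ (ρ a) b + 0ℤ * δ (ρ (ρ a)) b)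
      ≡⟨ cancel (δ a b) (nonRep a) (δ (ρ a) b) (δ (ρ (ρ a)) b) ⟩
    δ a b ∎
    where
    cancel : ∀ d t e f → d + t * e + (- t) * (e + 0ℤ * f) ≡ d
    cancel = solve-∀

  nonReps : Fin n → ℤ
  nonReps b = sum (λ c → nonRep c * δ (ρ c) b)

  module _ (A : Matrix k) (x : ℤ) where

    Mx F : Matrix n
    Mx a b = x * δ a b - A (φ a) (φ b)
    F  a b = x * δ a b - isRep a * (A (φ a) (φ b) * (1ℤ + nonReps b))

    V*Mx : ∀ a c → (V *ₘ Mx) a c ≡ x * δ a c + (- (x * nonRep a)) * δ (ρ a) c + (- (isRep a * A (φ a) (φ c))) * 1ℤ
    V*Mx a c = begin
      sum (λ c′ → V a c′ * Mx c′ c)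
        ≡⟨ sum-δ-pair a (ρ a) (- nonRep a) (λ c′ → Mx c′ c) ⟩
      x * δ a c - A (φ a) (φ c) + (- nonRep a) * (x * δ (ρ a) c - A (φ (ρ a)) (φ c))
        ≡⟨ cong (λ q → x * δ a c - A (φ a) (φ c) + (- nonRep a) * (x * δ (ρ a) c - A q (φ c))) (φ∘ρ a) ⟩
      x * δ a c - A (φ a) (φ c) + (- nonRep a) * (x * δ (ρ a) c - A (φ a) (φ c))
        ≡⟨ expand x (δ a c) (A (φ a) (φ c)) (isRep a) (δ (ρ a) c) ⟩
      x * δ a c + (- (x * nonRep a)) * δ (ρ a) c + (- (isRep a * A (φ a) (φ c))) * 1ℤ ∎
      where
      expand : ∀ x d y p e → x * d - y + (- (1ℤ - p)) * (x * e - y) ≡ x * d + (- (x * (1ℤ - p))) * e + (- (p * y)) * 1ℤ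
      expand = solve-∀

    A-along-fibre : ∀ a c b → A (φ a) (φ c) * δ (ρ c) b ≡ A (φ a) (φ b) * δ (ρ c) b
    A-along-fibre a c b with ρ c FinP.≟ b
    ... | yes ρc≡b = cong (λ q → A (φ a) q * δ (ρ c) b) (trans (sym (φ∘ρ c)) (cong φ ρc≡b))
    ... | no  ρc≢b = trans (cong (A (φ a) (φ c) *_) (δ-≢ ρc≢b))
                           (trans (ℤP.*-zeroʳ (A (φ a) (φ c)))
                                  (sym (trans (cong (A (φ a) (φ b) *_) (δ-≢ ρc≢b)) (ℤP.*-zeroʳ (A (φ a) (φ b))))))

    V*Mx*W≡F : ∀ a b → (V *ₘ Mx *ₘ W) a b ≡ F a b
    V*Mx*W≡F a b = begin
      sum (λ c → (V *ₘ Mx) a c * W c b)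
        ≡⟨ sum-cong-≗ (λ c → cong (_* W c b) (V*Mx a c)) ⟩
      sum (λ c → Y c * (δ c b + g c))
        ≡⟨ trans (sum-cong-≗ (λ c → ℤP.*-distribˡ-+ (Y c) (δ c b) (g c)))
                 (∑-distrib-+ (λ c → Y c * δ c b) (λ c → Y c * g c)) ⟩
      sum (λ c → Y c * δ c b) + sum (λ c → Y c * g c)
        ≡⟨ cong₂ _+_ (sum-δʳ b Y)
                     (sum-cong-≗ (λ c → split x (δ a c) (x * nonRep a) (δ (ρ a) c) (isRep a) (A (φ a) (φ c)) (g c))) ⟩
      Y b + sum (λ c → x * (δ a c * g c) + (- (x * nonRep a)) * (δ (ρ a) c * g c) + (- isRep a) * (A (φ a) (φ c) * g c))
        ≡⟨ cong (Y b +_) (sum-linear₃ x (- (x * nonRep a)) (- isRep a)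
                                      (λ c → δ a c * g c) (λ c → δ (ρ a) c * g c) (λ c → A (φ a) (φ c) * g c)) ⟩
      Y b + (x * sum (λ c → δ a c * g c) + (- (x * nonRep a)) * sum (λ c → δ (ρ a) c * g c)
             + (- isRep a) * sum (λ c → A (φ a) (φ c) * g c))
        ≡⟨ cong₂ (λ u v → Y b + (x * u + (- (x * nonRep a)) * v + (- isRep a) * sum (λ c → A (φ a) (φ c) * g c)))
                 (sum-δˡ a g) (trans (sum-δˡ (ρ a) g) g∘ρ≡0) ⟩
      Y b + (x * g a + (- (x * nonRep a)) * 0ℤ + (- isRep a) * sum (λ c → A (φ a) (φ c) * g c))
        ≡⟨ cong (λ w → Y b + (x * g a + (- (x * nonRep a)) * 0ℤ + (- isRep a) * w)) ∑A*g ⟩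
      Y b + (x * g a + (- (x * nonRep a)) * 0ℤ + (- isRep a) * (A (φ a) (φ b) * nonReps b))
        ≡⟨ collect x (δ a b) (nonRep a) (δ (ρ a) b) (isRep a) (A (φ a) (φ b)) (nonReps b) ⟩
      F a b ∎
      where
      Y : Fin n → ℤ
      Y c = x * δ a c + (- (x * nonRep a)) * δ (ρ a) c + (- (isRep a * A (φ a) (φ c))) * 1ℤ
      g : Fin n → ℤ
      g c = nonRep c * δ (ρ c) b
      g∘ρ≡0 : g (ρ a) ≡ 0ℤ
      g∘ρ≡0 = trans (cong (_* δ (ρ (ρ a)) b) (nonRep∘ρ a)) (ℤP.*-zeroˡ (δ (ρ (ρ a)) b))
      ∑A*g : sum (λ c → A (φ a) (φ c) * g c) ≡ A (φ a) (φ b) * nonReps b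
      ∑A*g = trans (sum-cong-≗ λ c → trans (swap (A (φ a) (φ c)) (nonRep c) (δ (ρ c) b))
                                         (trans (cong (nonRep c *_) (A-along-fibre a c b))
                                                (sym (swap (A (φ a) (φ b)) (nonRep c) (δ (ρ c) b)))))
                   (sym (*-distribˡ-sum (A (φ a) (φ b)) g))
        where
        swap : ∀ u v w → u * (v * w) ≡ v * (u * w)
        swap = solve-∀
      split : ∀ x d xn e p y z → (x * d + (- xn) * e + (- (p * y)) * 1ℤ) * z ≡ x * (d * z) + (- xn) * (e * z) + (- p) * (y * z)
      split = solve-∀
      collect : ∀ x d t e p y c → (x * d + (- (x * t)) * e + (- (p * y)) * 1ℤ)
                                  + (x * (t * e) + (- (x * t)) * 0ℤ + (- p) * (y * c)) ≡ x * d - p * (y * (1ℤ + c))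
      collect = solve-∀

    det-Mx≡det-F : det n Mx ≡ det n F
    det-Mx≡det-F = begin
      det n Mx                          ≡⟨ ℤP.*-identityʳ _ ⟨
      det n Mx * 1ℤ                     ≡⟨ cong (det n Mx *_) (trans (det-cong n V*W≡δ) (det-δ n)) ⟨
      det n Mx * det n (V *ₘ W)         ≡⟨ cong (det n Mx *_) (det-*ₘ n V W) ⟩
      det n Mx * (det n V * det n W)    ≡⟨ regroup (det n Mx) (det n V) (det n W) ⟩
      det n V * det n Mx * det n W      ≡⟨ cong (_* det n W) (det-*ₘ n V Mx) ⟨
      det n (V *ₘ Mx) * det n W         ≡⟨ det-*ₘ n (V *ₘ Mx) W ⟨
      det n (V *ₘ Mx *ₘ W)              ≡⟨ det-cong n V*Mx*W≡F ⟩
      det n F                           ∎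
      where
      regroup : ∀ a b c → a * (b * c) ≡ b * a * c
      regroup = solve-∀

  isRep-δ : ∀ q c → isRep c * δ (φ c) q ≡ δ (r q) c
  isRep-δ q c with φ c FinP.≟ q
  ... | yes refl = trans (cong₂ _*_ (δ-sym c (r (φ c))) (δ-refl (φ c))) (ℤP.*-identityʳ _)
  ... | no φc≢q  = trans (cong (isRep c *_) (δ-≢ φc≢q))
                         (trans (ℤP.*-zeroʳ (isRep c))
                                (sym (δ-≢ (λ rq≡c → φc≢q (trans (cong φ (sym rq≡c)) (φ∘r q))))))

  1+nonReps∘r : ∀ q → 1ℤ + nonReps (r q) ≡ fibreSize φ q
  1+nonReps∘r q = begin
    1ℤ + nonReps (r q)
      ≡⟨ cong₂ _+_ (sym (sum-δˡ (r q) (λ _ → 1ℤ)))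
                   (sum-cong-≗ (λ c → cong (nonRep c *_) (δ-injective r r-injective (φ c) q))) ⟩
    sum (λ c → δ (r q) c * 1ℤ) + sum (λ c → nonRep c * δ (φ c) q)
      ≡⟨ cong (_+ sum (λ c → nonRep c * δ (φ c) q))
              (sum-cong-≗ (λ c → trans (isRep-δ q c) (sym (ℤP.*-identityʳ _)))) ⟨
    sum (λ c → isRep c * δ (φ c) q) + sum (λ c → nonRep c * δ (φ c) q)
      ≡⟨ ∑-distrib-+ (λ c → isRep c * δ (φ c) q) (λ c → nonRep c * δ (φ c) q) ⟨
    sum (λ c → isRep c * δ (φ c) q + nonRep c * δ (φ c) q)
      ≡⟨ sum-cong-≗ (λ c → partition (isRep c) (δ (φ c) q)) ⟩
    fibreSize φ q ∎
    where
    partition : ∀ p t → p * t + (1ℤ - p) * t ≡ t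
    partition = solve-∀

  det-blowUp : ∀ m → (∀ q → fibreSize φ q ≡ m) → ∀ (A : Matrix k) x →
               det n (λ a b → x * δ a b - A (φ a) (φ b)) ≡ x ^ (n ∸ k) * det k (λ q q′ → x * δ q q′ - m * A q q′)
  det-blowUp m fibres A x = begin
    det n (Mx A x)                                           ≡⟨ det-Mx≡det-F A x ⟩
    det n (F A x)                                            ≡⟨ det-restrict n k r r-injective x (F A x) outside ⟩
    x ^ (n ∸ k) * det k (λ q q′ → F A x (r q) (r q′))        ≡⟨ cong (x ^ (n ∸ k) *_) (det-cong k F-on-image) ⟩
    x ^ (n ∸ k) * det k (λ q q′ → x * δ q q′ - m * A q q′)   ∎
    where
    outside : ∀ a → (∀ q → r q ≢ a) → ∀ b → F A x a b ≡ x * δ a b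
    outside a a∉r b =
      trans (cong (λ p → x * δ a b - p * (A (φ a) (φ b) * (1ℤ + nonReps b))) (δ-≢ (λ a≡ρa → a∉r (φ a) (sym a≡ρa))))
            (vanish (x * δ a b) (A (φ a) (φ b) * (1ℤ + nonReps b)))
      where
      vanish : ∀ u v → u - 0ℤ * v ≡ u
      vanish = solve-∀
    F-on-image : ∀ q q′ → F A x (r q) (r q′) ≡ x * δ q q′ - m * A q q′
    F-on-image q q′ = begin
      x * δ (r q) (r q′) - isRep (r q) * (A (φ (r q)) (φ (r q′)) * (1ℤ + nonReps (r q′)))
        ≡⟨ cong₂ (λ d p → x * d - p * (A (φ (r q)) (φ (r q′)) * (1ℤ + nonReps (r q′))))
                 (δ-injective r r-injective q q′) (trans (cong (λ q″ → δ (r q) (r q″)) (φ∘r q)) (δ-refl (r q))) ⟩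
      x * δ q q′ - 1ℤ * (A (φ (r q)) (φ (r q′)) * (1ℤ + nonReps (r q′)))
        ≡⟨ cong₂ (λ y c → x * δ q q′ - 1ℤ * (y * c))
                 (cong₂ A (φ∘r q) (φ∘r q′)) (trans (1+nonReps∘r q′) (fibres q′)) ⟩
      x * δ q q′ - 1ℤ * (A q q′ * m)
        ≡⟨ tidy x (δ q q′) (A q q′) m ⟩
      x * δ q q′ - m * A q q′ ∎
      where
      tidy : ∀ x d y m → x * d - 1ℤ * (y * m) ≡ x * d - m * y
      tidy = solve-∀

-- Integer polynomials: evaluation, roots and degree

evalₚ : Poly → ℤ → ℤ
evalₚ []      x = 0ℤ
evalₚ (a ∷ p) x = a + x * evalₚ p x

evalₚ-+ₚ : ∀ p q x → evalₚ (p +ₚ q) x ≡ evalₚ p x + evalₚ q x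
evalₚ-+ₚ []      q       x = sym (ℤP.+-identityˡ _)
evalₚ-+ₚ (a ∷ p) []      x = sym (ℤP.+-identityʳ _)
evalₚ-+ₚ (a ∷ p) (b ∷ q) x =
  trans (cong (λ z → a + b + x * z) (evalₚ-+ₚ p q x)) (regroup a b x (evalₚ p x) (evalₚ q x))
  where
  regroup : ∀ a b x u v → a + b + x * (u + v) ≡ a + x * u + (b + x * v)
  regroup = solve-∀

evalₚ-negₚ : ∀ p x → evalₚ (negₚ p) x ≡ - evalₚ p x
evalₚ-negₚ []      x = refl
evalₚ-negₚ (a ∷ p) x = trans (cong (λ z → - a + x * z) (evalₚ-negₚ p x)) (regroup a x (evalₚ p x))
  where
  regroup : ∀ a x u → - a + x * (- u) ≡ - (a + x * u)
  regroup = solve-∀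

evalₚ-scaleₚ : ∀ c p x → evalₚ (scaleₚ c p) x ≡ c * evalₚ p x
evalₚ-scaleₚ c []      x = sym (ℤP.*-zeroʳ c)
evalₚ-scaleₚ c (a ∷ p) x = trans (cong (λ z → c * a + x * z) (evalₚ-scaleₚ c p x)) (regroup c a x (evalₚ p x))
  where
  regroup : ∀ c a x u → c * a + x * (c * u) ≡ c * (a + x * u)
  regroup = solve-∀

evalₚ-*ₚ : ∀ p q x → evalₚ (p *ₚ q) x ≡ evalₚ p x * evalₚ q x
evalₚ-*ₚ []      q x = refl
evalₚ-*ₚ (a ∷ p) q x = begin
  evalₚ (scaleₚ a q +ₚ (0ℤ ∷ p *ₚ q)) x                 ≡⟨ evalₚ-+ₚ (scaleₚ a q) (0ℤ ∷ p *ₚ q) x ⟩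
  evalₚ (scaleₚ a q) x + (0ℤ + x * evalₚ (p *ₚ q) x)
    ≡⟨ cong₂ (λ u v → u + (0ℤ + x * v)) (evalₚ-scaleₚ a q x) (evalₚ-*ₚ p q x) ⟩
  a * evalₚ q x + (0ℤ + x * (evalₚ p x * evalₚ q x))    ≡⟨ regroup a x (evalₚ p x) (evalₚ q x) ⟩
  (a + x * evalₚ p x) * evalₚ q x                       ∎
  where
  regroup : ∀ a x u v → a * v + (0ℤ + x * (u * v)) ≡ (a + x * u) * v
  regroup = solve-∀

evalₚ-Σₚ : ∀ n (f : Fin n → Poly) x → evalₚ (Σₚ n f) x ≡ sum (λ j → evalₚ (f j) x)
evalₚ-Σₚ zero    f x = refl
evalₚ-Σₚ (suc n) f x =
  trans (evalₚ-+ₚ (f zero) (Σₚ n (f ∘ suc)) x) (cong (evalₚ (f zero) x +_) (evalₚ-Σₚ n (f ∘ suc) x))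

evalₚ-altₚ : ∀ k p x → evalₚ (altₚ k p) x ≡ sign k * evalₚ p x
evalₚ-altₚ zero    p x = sym (ℤP.*-identityˡ _)
evalₚ-altₚ (suc k) p x =
  trans (evalₚ-negₚ (altₚ k p) x) (trans (cong -_ (evalₚ-altₚ k p x)) (ℤP.neg-distribˡ-* (sign k) (evalₚ p x)))

minorₚ : ∀ {n} → (Fin (suc n) → Fin (suc n) → Poly) → Fin (suc n) → Fin n → Fin n → Poly
minorₚ M j i k = M (suc i) (punchIn j k)

laplaceTermₚ : ∀ n → (Fin (suc n) → Fin (suc n) → Poly) → Fin (suc n) → Poly
laplaceTermₚ n M j = altₚ (toℕ j) (M zero j *ₚ Defs.det n (minorₚ M j))

evalₚ-det : ∀ n (M : Fin n → Fin n → Poly) x → evalₚ (Defs.det n M) x ≡ det n (λ i j → evalₚ (M i j) x)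
evalₚ-det zero    M x = cong (1ℤ +_) (ℤP.*-zeroʳ x)
evalₚ-det (suc n) M x = trans (evalₚ-Σₚ (suc n) (laplaceTermₚ n M) x) (sum-cong-≗ λ j →
  trans (evalₚ-altₚ (toℕ j) (M zero j *ₚ Defs.det n (minorₚ M j)) x) (cong (sign (toℕ j) *_)
    (trans (evalₚ-*ₚ (M zero j) (Defs.det n (minorₚ M j)) x) (cong (evalₚ (M zero j) x *_) (evalₚ-det n (minorₚ M j) x)))))

charEntry : ∀ {n} → Fin n → Fin n → ℤ → Poly
charEntry i j a = (if ⌊ i FinP.≟ j ⌋ then Xₚ else []) +ₚ negₚ (constₚ a)

evalₚ-charEntry : ∀ {n} (i j : Fin n) a x → evalₚ (charEntry i j a) x ≡ x * δ i j - a
evalₚ-charEntry i j a x with i FinP.≟ j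
... | yes refl = trans (diagonal x a) (cong (λ d → x * d - a) (sym (δ-refl i)))
  where
  diagonal : ∀ x a → 0ℤ + - a + x * (1ℤ + x * 0ℤ) ≡ x * 1ℤ - a
  diagonal = solve-∀
... | no i≢j = trans (off-diagonal a x) (cong (λ d → x * d - a) (sym (δ-≢ i≢j)))
  where
  off-diagonal : ∀ a x → - a + x * 0ℤ ≡ x * 0ℤ - a
  off-diagonal = solve-∀

evalₚ-charPoly : ∀ n (A : Matrix n) x → evalₚ (charPoly n A) x ≡ det n (λ i j → x * δ i j - A i j)
evalₚ-charPoly n A x = trans (evalₚ-det n _ x) (det-cong n (λ i j → evalₚ-charEntry i j (A i j) x))

coeff-+ₚ : ∀ p q i → coeff (p +ₚ q) i ≡ coeff p i + coeff q i
coeff-+ₚ []      q       i       = sym (ℤP.+-identityˡ _)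
coeff-+ₚ (a ∷ p) []      zero    = sym (ℤP.+-identityʳ _)
coeff-+ₚ (a ∷ p) []      (suc i) = sym (ℤP.+-identityʳ _)
coeff-+ₚ (a ∷ p) (b ∷ q) zero    = refl
coeff-+ₚ (a ∷ p) (b ∷ q) (suc i) = coeff-+ₚ p q i

coeff-negₚ : ∀ p i → coeff (negₚ p) i ≡ - coeff p i
coeff-negₚ []      i       = refl
coeff-negₚ (a ∷ p) zero    = refl
coeff-negₚ (a ∷ p) (suc i) = coeff-negₚ p i

quotₚ : Poly → ℤ → Poly
quotₚ []          x₀ = []
quotₚ (a ∷ [])    x₀ = []
quotₚ (a ∷ b ∷ p) x₀ = evalₚ (b ∷ p) x₀ ∷ quotₚ (b ∷ p) x₀

evalₚ-quotₚ : ∀ p x₀ x → evalₚ p x ≡ evalₚ p x₀ + (x - x₀) * evalₚ (quotₚ p x₀) x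
evalₚ-quotₚ []          x₀ x = zero-case x x₀
  where
  zero-case : ∀ x x₀ → 0ℤ ≡ 0ℤ + (x - x₀) * 0ℤ
  zero-case = solve-∀
evalₚ-quotₚ (a ∷ [])    x₀ x = constant-case a x x₀
  where
  constant-case : ∀ a x x₀ → a + x * 0ℤ ≡ a + x₀ * 0ℤ + (x - x₀) * 0ℤ
  constant-case = solve-∀
evalₚ-quotₚ (a ∷ b ∷ p) x₀ x =
  trans (cong (λ z → a + x * z) (evalₚ-quotₚ (b ∷ p) x₀ x))
        (regroup a x x₀ (evalₚ (b ∷ p) x₀) (evalₚ (quotₚ (b ∷ p) x₀) x))
  where
  regroup : ∀ a x x₀ e q → a + x * (e + (x - x₀) * q) ≡ a + x₀ * e + (x - x₀) * (e + x * q)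
  regroup = solve-∀

quotₚ-zero : ∀ p x₀ → evalₚ p x₀ ≡ 0ℤ → (∀ i → coeff (quotₚ p x₀) i ≡ 0ℤ) → ∀ i → coeff p i ≡ 0ℤ
quotₚ-zero []          x₀ _     _     i       = refl
quotₚ-zero (a ∷ [])    x₀ p[x₀] _     zero    =
  trans (sym (ℤP.+-identityʳ a)) (trans (cong (a +_) (sym (ℤP.*-zeroʳ x₀))) p[x₀])
quotₚ-zero (a ∷ [])    x₀ _     _     (suc i) = refl
quotₚ-zero (a ∷ b ∷ p) x₀ p[x₀] q≡0 zero    =
  trans (sym (ℤP.+-identityʳ a)) (trans (cong (a +_) (sym (trans (cong (x₀ *_) (q≡0 zero)) (ℤP.*-zeroʳ x₀)))) p[x₀])
quotₚ-zero (a ∷ b ∷ p) x₀ _     q≡0 (suc i) = quotₚ-zero (b ∷ p) x₀ (q≡0 zero) (q≡0 ∘ suc) i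

length-quotₚ : ∀ L p x₀ → length p ℕ.≤ suc L → length (quotₚ p x₀) ℕ.≤ L
length-quotₚ L       []          x₀ _         = z≤n
length-quotₚ L       (a ∷ [])    x₀ _         = z≤n
length-quotₚ (suc L) (a ∷ b ∷ p) x₀ (s≤s len) = s≤s (length-quotₚ L (b ∷ p) x₀ len)

-- Each root s i removes one factor X - s i; a polynomial with more distinct roots than its length is zero.
vanishing : ∀ L p → length p ℕ.≤ L → (s : ℕ → ℤ) → Injective _≡_ _≡_ s →
            (∀ i → evalₚ p (s i) ≡ 0ℤ) → ∀ j → coeff p j ≡ 0ℤ
vanishing zero    []    _   s s-inj roots j = refl
vanishing (suc L) p     len s s-inj roots   =
  quotₚ-zero p (s 0) (roots 0)
    (vanishing L (quotₚ p (s 0)) (length-quotₚ L p (s 0) len) (s ∘ suc) (ℕP.suc-injective ∘ s-inj) quot-roots)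
  where
  quot-roots : ∀ i → evalₚ (quotₚ p (s 0)) (s (suc i)) ≡ 0ℤ
  quot-roots i with ℤP.i*j≡0⇒i≡0∨j≡0 (s (suc i) - s 0) product≡0
    where
    product≡0 : (s (suc i) - s 0) * evalₚ (quotₚ p (s 0)) (s (suc i)) ≡ 0ℤ
    product≡0 = trans (sym (ℤP.+-identityˡ _))
      (trans (cong (_+ (s (suc i) - s 0) * evalₚ (quotₚ p (s 0)) (s (suc i))) (sym (roots 0)))
             (trans (sym (evalₚ-quotₚ p (s 0) (s (suc i)))) (roots (suc i))))
  ... | inj₂ q≡0    = q≡0
  ... | inj₁ diff≡0 = ⊥-elim (ℕP.1+n≢0 (s-inj (ℤP.i-j≡0⇒i≡j (s (suc i)) (s 0) diff≡0)))

≈ₚ-from-evalₚ : ∀ p q (s : ℕ → ℤ) → Injective _≡_ _≡_ s →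
                (∀ i → evalₚ p (s i) ≡ evalₚ q (s i)) → p ≈ₚ q
≈ₚ-from-evalₚ p q s s-inj agree i = ℤP.i-j≡0⇒i≡j (coeff p i) (coeff q i) (begin
  coeff p i - coeff q i             ≡⟨ cong (coeff p i +_) (coeff-negₚ q i) ⟨
  coeff p i + coeff (negₚ q) i      ≡⟨ coeff-+ₚ p (negₚ q) i ⟨
  coeff (p +ₚ negₚ q) i             ≡⟨ vanishing _ (p +ₚ negₚ q) ℕP.≤-refl s s-inj roots i ⟩
  0ℤ                                ∎)
  where
  roots : ∀ j → evalₚ (p +ₚ negₚ q) (s j) ≡ 0ℤ
  roots j = trans (evalₚ-+ₚ p (negₚ q) (s j))
                  (trans (cong (evalₚ p (s j) +_) (evalₚ-negₚ q (s j))) (ℤP.i≡j⇒i-j≡0 (agree j)))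

evalₚ-resp-≈ₚ : ∀ p q → p ≈ₚ q → ∀ x → evalₚ p x ≡ evalₚ q x
evalₚ-resp-≈ₚ []      []      p≈q x = refl
evalₚ-resp-≈ₚ []      (b ∷ q) p≈q x =
  sym (trans (cong₂ (λ u v → u + x * v) (sym (p≈q zero)) (sym (evalₚ-resp-≈ₚ [] q (p≈q ∘ suc) x))) (zero-poly x))
  where
  zero-poly : ∀ x → 0ℤ + x * 0ℤ ≡ 0ℤ
  zero-poly = solve-∀
evalₚ-resp-≈ₚ (a ∷ p) []      p≈q x =
  trans (cong₂ (λ u v → u + x * v) (p≈q zero) (evalₚ-resp-≈ₚ p [] (p≈q ∘ suc) x)) (zero-poly x)
  where
  zero-poly : ∀ x → 0ℤ + x * 0ℤ ≡ 0ℤ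
  zero-poly = solve-∀
evalₚ-resp-≈ₚ (a ∷ p) (b ∷ q) p≈q x = cong₂ (λ u v → u + x * v) (p≈q zero) (evalₚ-resp-≈ₚ p q (p≈q ∘ suc) x)

DegreeAtMost : Poly → ℕ → Set
DegreeAtMost p d = ∀ j → d < j → coeff p j ≡ 0ℤ

coeff-scaleₚ : ∀ c p j → coeff (scaleₚ c p) j ≡ c * coeff p j
coeff-scaleₚ c []      j       = sym (ℤP.*-zeroʳ c)
coeff-scaleₚ c (a ∷ p) zero    = refl
coeff-scaleₚ c (a ∷ p) (suc j) = coeff-scaleₚ c p j

coeff-altₚ : ∀ k p j → coeff (altₚ k p) j ≡ sign k * coeff p j
coeff-altₚ zero    p j = sym (ℤP.*-identityˡ _)
coeff-altₚ (suc k) p j =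
  trans (coeff-negₚ (altₚ k p) j) (trans (cong -_ (coeff-altₚ k p j)) (ℤP.neg-distribˡ-* (sign k) (coeff p j)))

coeff-Σₚ : ∀ n (f : Fin n → Poly) j → coeff (Σₚ n f) j ≡ sum (λ i → coeff (f i) j)
coeff-Σₚ zero    f j = refl
coeff-Σₚ (suc n) f j = trans (coeff-+ₚ (f zero) (Σₚ n (f ∘ suc)) j) (cong (coeff (f zero) j +_) (coeff-Σₚ n (f ∘ suc) j))

coeff-*ₚ-zero : ∀ a p q → coeff ((a ∷ p) *ₚ q) zero ≡ a * coeff q zero
coeff-*ₚ-zero a p q = trans (coeff-+ₚ (scaleₚ a q) (0ℤ ∷ p *ₚ q) zero) (trans (ℤP.+-identityʳ _) (coeff-scaleₚ a q zero))

coeff-*ₚ-suc : ∀ a p q j → coeff ((a ∷ p) *ₚ q) (suc j) ≡ a * coeff q (suc j) + coeff (p *ₚ q) j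
coeff-*ₚ-suc a p q j =
  trans (coeff-+ₚ (scaleₚ a q) (0ℤ ∷ p *ₚ q) (suc j)) (cong (_+ coeff (p *ₚ q) j) (coeff-scaleₚ a q (suc j)))

zero-*ₚ : ∀ p q → (∀ j → coeff p j ≡ 0ℤ) → ∀ j → coeff (p *ₚ q) j ≡ 0ℤ
zero-*ₚ []      q p≡0 j       = refl
zero-*ₚ (a ∷ p) q p≡0 zero    =
  trans (coeff-*ₚ-zero a p q) (trans (cong (_* coeff q zero) (p≡0 zero)) (ℤP.*-zeroˡ (coeff q zero)))
zero-*ₚ (a ∷ p) q p≡0 (suc j) =
  trans (coeff-*ₚ-suc a p q j) (trans (cong₂ (λ u v → u * coeff q (suc j) + v) (p≡0 zero) (zero-*ₚ p q (p≡0 ∘ suc) j))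
                                      (trans (ℤP.+-identityʳ _) (ℤP.*-zeroˡ (coeff q (suc j)))))

degree-*ₚ : ∀ p q a b → DegreeAtMost p a → DegreeAtMost q b → DegreeAtMost (p *ₚ q) (a ℕ.+ b)
degree-*ₚ []      q a       b deg-p deg-q j       a+b<j       = refl
degree-*ₚ (c ∷ p) q zero    b deg-p deg-q (suc j) (s≤s b<j) =
  trans (coeff-*ₚ-suc c p q j)
        (trans (cong₂ (λ u v → c * u + v) (deg-q (suc j) (s≤s b<j)) (zero-*ₚ p q (λ i → deg-p (suc i) (s≤s z≤n)) j))
               (trans (ℤP.+-identityʳ _) (ℤP.*-zeroʳ c)))
degree-*ₚ (c ∷ p) q (suc a) b deg-p deg-q (suc j) (s≤s a+b<j) =
  trans (coeff-*ₚ-suc c p q j)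
        (trans (cong₂ (λ u v → c * u + v) (deg-q (suc j) (s≤s (ℕP.≤-trans (ℕP.m≤n+m b a) (ℕP.<⇒≤ a+b<j))))
                                          (degree-*ₚ p q a b (λ i a<i → deg-p (suc i) (s≤s a<i)) deg-q j a+b<j))
               (trans (ℤP.+-identityʳ _) (ℤP.*-zeroʳ c)))

leading-*ₚ : ∀ p q a b → DegreeAtMost p a → DegreeAtMost q b → coeff (p *ₚ q) (a ℕ.+ b) ≡ coeff p a * coeff q b
leading-*ₚ []      q a       b       deg-p deg-q = refl
leading-*ₚ (c ∷ p) q zero    zero    deg-p deg-q = coeff-*ₚ-zero c p q
leading-*ₚ (c ∷ p) q zero    (suc b) deg-p deg-q =
  trans (coeff-*ₚ-suc c p q b)
        (trans (cong (c * coeff q (suc b) +_) (zero-*ₚ p q (λ i → deg-p (suc i) (s≤s z≤n)) b)) (ℤP.+-identityʳ _))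
leading-*ₚ (c ∷ p) q (suc a) b       deg-p deg-q =
  trans (coeff-*ₚ-suc c p q (a ℕ.+ b))
        (trans (cong₂ (λ u v → c * u + v) (deg-q (suc (a ℕ.+ b)) (s≤s (ℕP.m≤n+m b a)))
                                          (leading-*ₚ p q a b (λ i a<i → deg-p (suc i) (s≤s a<i)) deg-q))
               (trans (cong (_+ coeff p a * coeff q b) (ℤP.*-zeroʳ c)) (ℤP.+-identityˡ _)))

degree-altₚ : ∀ k p d → DegreeAtMost p d → DegreeAtMost (altₚ k p) d
degree-altₚ k p d deg-p j d<j = trans (coeff-altₚ k p j) (trans (cong (sign k *_) (deg-p j d<j)) (ℤP.*-zeroʳ (sign k)))

degree-Σₚ : ∀ n (f : Fin n → Poly) d → (∀ i → DegreeAtMost (f i) d) → DegreeAtMost (Σₚ n f) d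
degree-Σₚ n f d deg-f j d<j = trans (coeff-Σₚ n f j) (sum-zero _ (λ i → deg-f i j d<j))

degree-det : ∀ n (M : Fin n → Fin n → Poly) → (∀ i j → DegreeAtMost (M i j) 1) → DegreeAtMost (Defs.det n M) n
degree-det zero    M deg-M (suc j) _ = refl
degree-det (suc n) M deg-M = degree-Σₚ (suc n) (laplaceTermₚ n M) (suc n) λ j →
  degree-altₚ (toℕ j) _ (suc n) (degree-*ₚ (M zero j) _ 1 n (deg-M zero j)
    (degree-det n (minorₚ M j) (λ i k → deg-M (suc i) (punchIn j k))))

-- Only the product of the diagonal entries reaches degree n.
leading-det : ∀ n (M : Fin n → Fin n → Poly) → (∀ i j → DegreeAtMost (M i j) 1) →
              (∀ i j → i ≢ j → DegreeAtMost (M i j) 0) → (∀ i → coeff (M i i) 1 ≡ 1ℤ) →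
              coeff (Defs.det n M) n ≡ 1ℤ
leading-det zero    M deg₁ deg₀ lead = refl
leading-det (suc n) M deg₁ deg₀ lead =
  trans (coeff-Σₚ (suc n) (laplaceTermₚ n M) (suc n))
        (trans (cong₂ _+_ diagonal-term (sum-zero _ other-terms)) (ℤP.+-identityʳ 1ℤ))
  where
  diagonal-term : coeff (laplaceTermₚ n M zero) (suc n) ≡ 1ℤ
  diagonal-term = trans (leading-*ₚ (M zero zero) (Defs.det n (minorₚ M zero)) 1 n (deg₁ zero zero)
                                    (degree-det n (minorₚ M zero) (λ i k → deg₁ (suc i) (suc k))))
    (trans (cong₂ _*_ (lead zero) (leading-det n (minorₚ M zero) (λ i k → deg₁ (suc i) (suc k))
                                     (λ i k i≢k → deg₀ (suc i) (suc k) (i≢k ∘ FinP.suc-injective)) (lead ∘ suc)))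
           (ℤP.*-identityˡ 1ℤ))
  other-terms : ∀ j → coeff (laplaceTermₚ n M (suc j)) (suc n) ≡ 0ℤ
  other-terms j = degree-altₚ (suc (toℕ j)) _ n
    (degree-*ₚ (M zero (suc j)) _ 0 n (deg₀ zero (suc j) (λ ()))
               (degree-det n (minorₚ M (suc j)) (λ i k → deg₁ (suc i) (punchIn (suc j) k))))
    (suc n) ℕP.≤-refl

charEntry-degree₁ : ∀ {n} (i j : Fin n) a → DegreeAtMost (charEntry i j a) 1
charEntry-degree₁ i j a (suc zero)    (s≤s ())
charEntry-degree₁ i j a (suc (suc t)) _ with i FinP.≟ j
... | yes _ = refl
... | no  _ = refl

charEntry-degree₀ : ∀ {n} (i j : Fin n) a → i ≢ j → DegreeAtMost (charEntry i j a) 0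
charEntry-degree₀ i j a i≢j (suc t) _ with i FinP.≟ j
... | yes i≡j = ⊥-elim (i≢j i≡j)
... | no  _   = refl

charEntry-leading : ∀ {n} (i : Fin n) a → coeff (charEntry i i a) 1 ≡ 1ℤ
charEntry-leading i a with i FinP.≟ i
... | yes _   = refl
... | no  i≢i = ⊥-elim (i≢i refl)

charPoly-degree : ∀ n (A : Matrix n) → DegreeAtMost (charPoly n A) n
charPoly-degree n A = degree-det n _ (λ i j → charEntry-degree₁ i j (A i j))

charPoly-leading : ∀ n (A : Matrix n) → coeff (charPoly n A) n ≡ 1ℤ
charPoly-leading n A = leading-det n _ (λ i j → charEntry-degree₁ i j (A i j))
  (λ i j i≢j → charEntry-degree₀ i j (A i j) i≢j) (λ i → charEntry-leading i (A i i))

charPoly-≈ₚ⇒size-≡ : ∀ k k′ (A : Matrix k) (B : Matrix k′) → charPoly k A ≈ₚ charPoly k′ B → k ≡ k′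
charPoly-≈ₚ⇒size-≡ k k′ A B A≈B with ℕP.<-cmp k k′
... | tri≈ _ k≡k′ _ = k≡k′
... | tri< k<k′ _ _ = ⊥-elim (0≢1 (trans (sym (charPoly-degree k A k′ k<k′)) (trans (A≈B k′) (charPoly-leading k′ B))))
  where
  0≢1 : 0ℤ ≢ 1ℤ
  0≢1 ()
... | tri> _ _ k′<k = ⊥-elim (0≢1 (trans (sym (charPoly-degree k′ B k k′<k)) (trans (sym (A≈B k)) (charPoly-leading k A))))
  where
  0≢1 : 0ℤ ≢ 1ℤ
  0≢1 ()

-- Blow-ups of graphs

Adjacency : ℕ → Set
Adjacency n = Fin n → Fin n → Bool

adjacencyMatrix : ∀ {n} → Adjacency n → Matrix n
adjacencyMatrix X a b = if X a b then ℤ.+ 1 else ℤ.+ 0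

Cospectral : ∀ {n m} → Adjacency n → Adjacency m → Set
Cospectral {n} {m} X Y = charPoly n (adjacencyMatrix X) ≈ₚ charPoly m (adjacencyMatrix Y)

infix 4 _≅_
_≅_ : ∀ {n m} → Adjacency n → Adjacency m → Set
_≅_ {n} {m} X Y = Σ (Fin n ↔ Fin m) λ f → ∀ a b → X a b ≡ Y (Inverse.to f a) (Inverse.to f b)

blowUp : ∀ {n k} → (Fin n → Fin k) → Adjacency k → Adjacency n
blowUp φ X a b = X (φ a) (φ b)

≅-resp : ∀ {n m} {X X′ : Adjacency n} {Y Y′ : Adjacency m} →
         (∀ a b → X a b ≡ X′ a b) → (∀ a b → Y a b ≡ Y′ a b) → X ≅ Y → X′ ≅ Y′
≅-resp X≗X′ Y≗Y′ (f , iso) = f , λ a b → trans (sym (X≗X′ a b)) (trans (iso a b) (Y≗Y′ _ _))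

charPoly-cong : ∀ n {A B : Matrix n} → (∀ i j → A i j ≡ B i j) → charPoly n A ≈ₚ charPoly n B
charPoly-cong n {A} {B} A≗B = ≈ₚ-from-evalₚ (charPoly n A) (charPoly n B) ℤ.+_ ℤP.+-injective λ y → begin
  evalₚ (charPoly n A) (ℤ.+ y)                 ≡⟨ evalₚ-charPoly n A (ℤ.+ y) ⟩
  det n (λ i j → ℤ.+ y * δ i j - A i j)        ≡⟨ det-cong n (λ i j → cong (λ a → ℤ.+ y * δ i j - a) (A≗B i j)) ⟩
  det n (λ i j → ℤ.+ y * δ i j - B i j)        ≡⟨ evalₚ-charPoly n B (ℤ.+ y) ⟨
  evalₚ (charPoly n B) (ℤ.+ y)                 ∎

Cospectral-resp : ∀ {n m} {X X′ : Adjacency n} {Y Y′ : Adjacency m} →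
                  (∀ a b → X a b ≡ X′ a b) → (∀ a b → Y a b ≡ Y′ a b) → Cospectral X Y → Cospectral X′ Y′
Cospectral-resp {n} {m} X≗X′ Y≗Y′ X∼Y i =
  trans (sym (charPoly-cong n (λ a b → cong (λ t → if t then ℤ.+ 1 else ℤ.+ 0) (X≗X′ a b)) i))
        (trans (X∼Y i) (charPoly-cong m (λ a b → cong (λ t → if t then ℤ.+ 1 else ℤ.+ 0) (Y≗Y′ a b)) i))

-- Evaluating at multiples of the fibre size m turns det (x I - m A) of the blow-up formula into m ^ k det (y I - A).
cospectral-blowUp : ∀ {n k} (φ : Fin n → Fin k) → Surj φ → ∀ m → m ≢ 0ℤ → (∀ q → fibreSize φ q ≡ m) →
                    ∀ (X Y : Adjacency k) → Cospectral X Y → Cospectral (blowUp φ X) (blowUp φ Y)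
cospectral-blowUp {n} {k} φ surj m m≢0 fibres X Y X∼Y =
  ≈ₚ-from-evalₚ (charPoly n (adjacencyMatrix (blowUp φ X))) (charPoly n (adjacencyMatrix (blowUp φ Y)))
                (λ y → m * ℤ.+ y) m*-injective λ y → begin
    evalₚ (charPoly n (adjacencyMatrix (blowUp φ X))) (m * ℤ.+ y)      ≡⟨ evalₚ-blowUp X y ⟩
    (m * ℤ.+ y) ^ (n ∸ k) * (m ^ k * evalₚ (charPoly k (adjacencyMatrix X)) (ℤ.+ y))
      ≡⟨ cong (λ v → (m * ℤ.+ y) ^ (n ∸ k) * (m ^ k * v))
              (evalₚ-resp-≈ₚ (charPoly k (adjacencyMatrix X)) (charPoly k (adjacencyMatrix Y)) X∼Y (ℤ.+ y)) ⟩
    (m * ℤ.+ y) ^ (n ∸ k) * (m ^ k * evalₚ (charPoly k (adjacencyMatrix Y)) (ℤ.+ y))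
      ≡⟨ evalₚ-blowUp Y y ⟨
    evalₚ (charPoly n (adjacencyMatrix (blowUp φ Y))) (m * ℤ.+ y)      ∎
  where
  m*-injective : Injective _≡_ _≡_ (λ y → m * ℤ.+ y)
  m*-injective eq = ℤP.+-injective (ℤP.*-cancelˡ-≡ m _ _ {{ℤ.≢-nonZero m≢0}} eq)
  open BlowUp φ (proj₁ ∘ surj) (proj₂ ∘ surj)
  evalₚ-blowUp : ∀ X y → evalₚ (charPoly n (adjacencyMatrix (blowUp φ X))) (m * ℤ.+ y)
                         ≡ (m * ℤ.+ y) ^ (n ∸ k) * (m ^ k * evalₚ (charPoly k (adjacencyMatrix X)) (ℤ.+ y))
  evalₚ-blowUp X y = begin
    evalₚ (charPoly n (adjacencyMatrix (blowUp φ X))) (m * ℤ.+ y)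
      ≡⟨ evalₚ-charPoly n _ (m * ℤ.+ y) ⟩
    det n (λ a b → m * ℤ.+ y * δ a b - adjacencyMatrix X (φ a) (φ b))
      ≡⟨ det-blowUp m fibres (adjacencyMatrix X) (m * ℤ.+ y) ⟩
    (m * ℤ.+ y) ^ (n ∸ k) * det k (λ q q′ → m * ℤ.+ y * δ q q′ - m * adjacencyMatrix X q q′)
      ≡⟨ cong ((m * ℤ.+ y) ^ (n ∸ k) *_)
              (trans (det-cong k (λ q q′ → factor m (ℤ.+ y) (δ q q′) (adjacencyMatrix X q q′)))
                     (det-scale k m (λ q q′ → ℤ.+ y * δ q q′ - adjacencyMatrix X q q′))) ⟩
    (m * ℤ.+ y) ^ (n ∸ k) * (m ^ k * det k (λ q q′ → ℤ.+ y * δ q q′ - adjacencyMatrix X q q′))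
      ≡⟨ cong (λ v → (m * ℤ.+ y) ^ (n ∸ k) * (m ^ k * v)) (evalₚ-charPoly k (adjacencyMatrix X) (ℤ.+ y)) ⟨
    (m * ℤ.+ y) ^ (n ∸ k) * (m ^ k * evalₚ (charPoly k (adjacencyMatrix X)) (ℤ.+ y)) ∎
    where
    factor : ∀ m y d a → m * y * d - m * a ≡ m * (y * d - a)
    factor = solve-∀

-- Cancellation of blow-ups

module Matching {c ℓ} (S : DecSetoid c ℓ) where
  open DecSetoid S using (Carrier; _≈_; _≟_) renaming (refl to ≈-refl; sym to ≈-sym; trans to ≈-trans)

  indicator : ∀ {p} {P : Set p} → Dec P → ℤ
  indicator (yes _) = 1ℤ
  indicator (no  _) = 0ℤ

  count : ∀ {k} → (Fin k → Carrier) → Carrier → ℤ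
  count α y = sum (λ i → indicator (α i ≟ y))

  indicator-natural : ∀ x y → ∃ λ t → indicator (x ≟ y) ≡ ℤ.+ t
  indicator-natural x y with x ≟ y
  ... | yes _ = 1 , refl
  ... | no  _ = 0 , refl

  indicator-refl : ∀ x → indicator (x ≟ x) ≡ 1ℤ
  indicator-refl x with x ≟ x
  ... | yes _   = refl
  ... | no  x≉x = ⊥-elim (x≉x ≈-refl)

  indicator-nonzero : ∀ x y → indicator (x ≟ y) ≢ 0ℤ → x ≈ y
  indicator-nonzero x y ind≢0 with x ≟ y
  ... | yes x≈y = x≈y
  ... | no  _   = ⊥-elim (ind≢0 refl)

  indicator-resp : ∀ {x x′} y → x ≈ x′ → indicator (x ≟ y) ≡ indicator (x′ ≟ y)
  indicator-resp {x} {x′} y x≈x′ with x ≟ y | x′ ≟ y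
  ... | yes _   | yes _    = refl
  ... | yes x≈y | no  x′≉y = ⊥-elim (x′≉y (≈-trans (≈-sym x≈x′) x≈y))
  ... | no  x≉y | yes x′≈y = ⊥-elim (x≉y (≈-trans x≈x′ x′≈y))
  ... | no  _   | no  _    = refl

  -- Match α 0 with some β j in its class, remove both and recurse.
  matching : ∀ k (α β : Fin k → Carrier) → (∀ y → count α y ≡ count β y) →
             Σ (Fin k ↔ Fin k) λ π → ∀ i → β (π ⟨$⟩ʳ i) ≈ α i
  matching zero    α β counts = Perm.id , λ ()
  matching (suc k) α β counts = π , related
    where
    count-α₀ : count α (α zero) ≢ 0ℤ
    count-α₀ = sum-natural-nonzero _ zero (indicator-refl (α zero)) (λ i → indicator-natural (α i) (α zero))
    partner : ∃ λ j → indicator (β j ≟ α zero) ≢ 0ℤ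
    partner = sum-nonzero⇒term-nonzero _ (λ ∑≡0 → count-α₀ (trans (counts (α zero)) ∑≡0))
    j : Fin (suc k)
    j = proj₁ partner
    βj≈α₀ : β j ≈ α zero
    βj≈α₀ = indicator-nonzero (β j) (α zero) (proj₂ partner)
    counts′ : ∀ y → count (α ∘ suc) y ≡ count (β ∘ punchIn j) y
    counts′ y = +-cancelˡ (indicator (α zero ≟ y)) (count (α ∘ suc) y) (count (β ∘ punchIn j) y)
      (trans (counts y) (trans (sum-remove {i = j} (λ i → indicator (β i ≟ y)))
                               (cong (_+ count (β ∘ punchIn j) y) (indicator-resp y βj≈α₀))))
    π₀ : Fin k ↔ Fin k
    π₀ = proj₁ (matching k (α ∘ suc) (β ∘ punchIn j) counts′)
    π : Fin (suc k) ↔ Fin (suc k)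
    π = insert zero j π₀
    related : ∀ i → β (π ⟨$⟩ʳ i) ≈ α i
    related zero    = βj≈α₀
    related (suc i) = subst (λ b → β b ≈ α (suc i)) (sym (insert-punchIn zero j π₀ i))
                        (proj₂ (matching k (α ∘ suc) (β ∘ punchIn j) counts′) i)

twins : ∀ {k} → Adjacency k → DecSetoid 0ℓ 0ℓ
twins {k} Y = record
  { Carrier = Fin k
  ; _≈_     = λ u v → ∀ w → Y u w ≡ Y v w
  ; isDecEquivalence = record
    { isEquivalence = record { refl = λ _ → refl ; sym = λ u~v w → sym (u~v w) ; trans = λ u~v v~w w → trans (u~v w) (v~w w) }
    ; _≟_ = λ u v → FinP.all? (λ w → Y u w BoolP.≟ Y v w)
    }
  }

-- With r a section of φ and f the isomorphism of the blow-ups, h = φ ∘ f ∘ r need not be a bijection, but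
-- h (φ a) and φ (f a) are twins in Y; counting over fibres shows that h meets every twin class of Y as often
-- as the identity does, so h can be corrected inside twin classes to a bijection.
cancel-blowUp : ∀ {n k} (φ : Fin n → Fin k) → Surj φ → ∀ m → m ≢ 0ℤ → (∀ q → fibreSize φ q ≡ m) →
                ∀ (X Y : Adjacency k) → (∀ u v → Y u v ≡ Y v u) → blowUp φ X ≅ blowUp φ Y → X ≅ Y
cancel-blowUp {n} {k} φ surj m m≢0 fibres X Y Y-sym (f , iso) = π , adjacent
  where
  open Matching (twins Y)
  open DecSetoid (twins Y) using (_≈_; _≟_)

  r : Fin k → Fin n
  r q = proj₁ (surj q)
  φ∘r : ∀ q → φ (r q) ≡ q
  φ∘r q = proj₂ (surj q)

  h : Fin k → Fin k
  h q = φ (Inverse.to f (r q))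

  X-via-h : ∀ q q′ → X q q′ ≡ Y (h q) (h q′)
  X-via-h q q′ = trans (cong₂ X (sym (φ∘r q)) (sym (φ∘r q′))) (iso (r q) (r q′))

  twin : ∀ a → h (φ a) ≈ φ (Inverse.to f a)
  twin a w = begin
    Y (h (φ a)) w                                       ≡⟨ cong (Y (h (φ a))) (sym φfc≡w) ⟩
    Y (φ (Inverse.to f (r (φ a)))) (φ (Inverse.to f c)) ≡⟨ iso (r (φ a)) c ⟨
    X (φ (r (φ a))) (φ c)                               ≡⟨ cong (λ q → X q (φ c)) (φ∘r (φ a)) ⟩
    X (φ a) (φ c)                                       ≡⟨ iso a c ⟩
    Y (φ (Inverse.to f a)) (φ (Inverse.to f c))         ≡⟨ cong (Y (φ (Inverse.to f a))) φfc≡w ⟩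
    Y (φ (Inverse.to f a)) w                            ∎
    where
    c : Fin n
    c = Inverse.from f (r w)
    φfc≡w : φ (Inverse.to f c) ≡ w
    φfc≡w = trans (cong φ (Inverse.strictlyInverseˡ f (r w))) (φ∘r w)

  counts : ∀ y → count h y ≡ count (λ q → q) y
  counts y = ℤP.*-cancelˡ-≡ m (count h y) (count (λ q → q) y) {{ℤ.≢-nonZero m≢0}} (begin
    m * count h y                                       ≡⟨ sum-over-fibres φ m fibres (λ q → indicator (h q ≟ y)) ⟨
    sum (λ a → indicator (h (φ a) ≟ y))                 ≡⟨ sum-cong-≗ (λ a → indicator-resp y (twin a)) ⟩
    sum (λ a → indicator (φ (Inverse.to f a) ≟ y))      ≡⟨ sum-permute (λ a → indicator (φ a ≟ y)) f ⟨
    sum (λ a → indicator (φ a ≟ y))                     ≡⟨ sum-over-fibres φ m fibres (λ q → indicator (q ≟ y)) ⟩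
    m * count (λ q → q) y                               ∎)

  π : Fin k ↔ Fin k
  π = proj₁ (matching k h (λ q → q) counts)

  adjacent : ∀ q q′ → X q q′ ≡ Y (π ⟨$⟩ʳ q) (π ⟨$⟩ʳ q′)
  adjacent q q′ = begin
    X q q′                         ≡⟨ X-via-h q q′ ⟩
    Y (h q) (h q′)                 ≡⟨ Y-sym (h q) (h q′) ⟩
    Y (h q′) (h q)                 ≡⟨ π≈h q′ (h q) ⟨
    Y (π ⟨$⟩ʳ q′) (h q)            ≡⟨ Y-sym (π ⟨$⟩ʳ q′) (h q) ⟩
    Y (h q) (π ⟨$⟩ʳ q′)            ≡⟨ π≈h q (π ⟨$⟩ʳ q′) ⟨
    Y (π ⟨$⟩ʳ q) (π ⟨$⟩ʳ q′)       ∎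
    where
    π≈h : ∀ q → π ⟨$⟩ʳ q ≈ h q
    π≈h = proj₂ (matching k h (λ q → q) counts)

-- Cayley graphs along group homomorphisms

toGroup : ∀ {n} → FinGroup n → Group 0ℓ 0ℓ
toGroup {n} G = record
  { Carrier = Fin n ; _≈_ = _≡_ ; _∙_ = _∙_ G ; ε = e G ; _⁻¹ = inv G
  ; isGroup = record
    { isMonoid = record
      { isSemigroup = record { isMagma = record { isEquivalence = isEquivalence ; ∙-cong = cong₂ (_∙_ G) } ; assoc = assoc G }
      ; identity = idˡ G , idʳ G
      }
    ; inverse = invˡ G , invʳ G
    ; ⁻¹-cong = cong (inv G)
    }
  }

module _ {n k} (G : FinGroup n) (Q : FinGroup k) (φ : Fin n → Fin k) (φ-hom : IsHom G Q φ) where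
  open GroupProperties (toGroup Q) using (identityʳ-unique; inverseˡ-unique)

  hom-e : φ (e G) ≡ e Q
  hom-e = identityʳ-unique (φ (e G)) (φ (e G)) (trans (sym (φ-hom (e G) (e G))) (cong φ (idˡ G (e G))))

  hom-inv : ∀ x → φ (inv G x) ≡ inv Q (φ x)
  hom-inv x = inverseˡ-unique (φ (inv G x)) (φ x) (trans (sym (φ-hom (inv G x) x)) (trans (cong φ (invˡ G x)) hom-e))

  cayAdj-pullback : ∀ (S : Fin k → Bool) a b → cayAdj G (S ∘ φ) a b ≡ cayAdj Q S (φ a) (φ b)
  cayAdj-pullback S a b = cong S (trans (φ-hom a (inv G b)) (cong (_∙_ Q (φ a)) (hom-inv b)))

  connectionSet-pullback : ∀ {S : Fin k → Bool} → IsConnectionSet Q S → IsConnectionSet G (S ∘ φ)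
  connectionSet-pullback {S} (e∉S , S⁻¹≡S) = trans (cong S hom-e) e∉S , λ x → trans (cong S (hom-inv x)) (S⁻¹≡S (φ x))

  -- Right translation by a preimage of q maps the fibre over e Q onto the fibre over q.
  hom-fibreSize : Surj φ → ∀ q → fibreSize φ q ≡ fibreSize φ (e Q)
  hom-fibreSize surj q = trans (sum-permute (λ c → δ (φ c) q) translation) (sum-cong-≗ shifted)
    where
    open GroupProperties (toGroup Q) using (∙-cancelʳ)
    g : Fin n
    g = proj₁ (surj q)
    translation : Fin n ↔ Fin n
    translation = mk↔ₛ′ (λ c → _∙_ G c g) (λ c → _∙_ G c (inv G g))
      (λ c → trans (assoc G c (inv G g) g) (trans (cong (_∙_ G c) (invˡ G g)) (idʳ G c)))
      (λ c → trans (assoc G c g (inv G g)) (trans (cong (_∙_ G c) (invʳ G g)) (idʳ G c)))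
    shifted : ∀ c → δ (φ (_∙_ G c g)) q ≡ δ (φ c) (e Q)
    shifted c = trans (cong₂ δ (trans (φ-hom c g) (cong (_∙_ Q (φ c)) (proj₂ (surj q)))) (sym (idˡ Q q)))
                      (δ-injective (λ z → _∙_ Q z q) (λ {x} {y} → ∙-cancelʳ q x y) (φ c) (e Q))

cayAdj-symmetric : ∀ {k} (H : FinGroup k) {T : Fin k → Bool} → IsConnectionSet H T → ∀ u v → cayAdj H T u v ≡ cayAdj H T v u
cayAdj-symmetric H {T} (_ , T⁻¹≡T) u v =
  trans (sym (T⁻¹≡T (_∙_ H u (inv H v))))
        (cong T (trans (⁻¹-anti-homo-∙ u (inv H v)) (cong (λ w → _∙_ H w (inv H u)) (⁻¹-involutive v))))
  where
  open GroupProperties (toGroup H) using (⁻¹-anti-homo-∙; ⁻¹-involutive)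

-- Given a surjective homomorphism φ : G → Q with section r and a group H on the same set as Q, the group
-- H × ker φ transported to Fin n along a ↦ (φ a , a · r (φ a)⁻¹); φ becomes the projection onto H.
module ProductWithKernel {n k} (G : FinGroup n) (Q : FinGroup k) (φ : Fin n → Fin k) (φ-hom : IsHom G Q φ)
                         (surj : Surj φ) (H : FinGroup k) where
  open GroupProperties (toGroup Q) using (ε⁻¹≈ε)

  r : Fin k → Fin n
  r q = proj₁ (surj q)

  φ∘r : ∀ q → φ (r q) ≡ q
  φ∘r q = proj₂ (surj q)

  InKernel : Fin n → Set
  InKernel z = φ z ≡ e Q

  κ : Fin n → Fin n
  κ a = _∙_ G a (inv G (r (φ a)))

  ⟨_,_⟩ : Fin k → Fin n → Fin n
  ⟨ h , z ⟩ = _∙_ G z (r h)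

  ⟨φ,κ⟩ : ∀ a → ⟨ φ a , κ a ⟩ ≡ a
  ⟨φ,κ⟩ a = trans (assoc G a (inv G (r (φ a))) (r (φ a))) (trans (cong (_∙_ G a) (invˡ G (r (φ a)))) (idʳ G a))

  φ-⟨,⟩ : ∀ h z → InKernel z → φ ⟨ h , z ⟩ ≡ h
  φ-⟨,⟩ h z z∈K = trans (φ-hom z (r h)) (trans (cong₂ (_∙_ Q) z∈K (φ∘r h)) (idˡ Q h))

  κ-⟨,⟩ : ∀ h z → InKernel z → κ ⟨ h , z ⟩ ≡ z
  κ-⟨,⟩ h z z∈K = begin
    _∙_ G ⟨ h , z ⟩ (inv G (r (φ ⟨ h , z ⟩)))
      ≡⟨ cong (λ q → _∙_ G ⟨ h , z ⟩ (inv G (r q))) (φ-⟨,⟩ h z z∈K) ⟩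
    _∙_ G (_∙_ G z (r h)) (inv G (r h))
      ≡⟨ assoc G z (r h) (inv G (r h)) ⟩
    _∙_ G z (_∙_ G (r h) (inv G (r h)))
      ≡⟨ cong (_∙_ G z) (invʳ G (r h)) ⟩
    _∙_ G z (e G)
      ≡⟨ idʳ G z ⟩
    z ∎

  κ∈K : ∀ a → InKernel (κ a)
  κ∈K a = trans (φ-hom a (inv G (r (φ a))))
                (trans (cong (_∙_ Q (φ a)) (trans (hom-inv G Q φ φ-hom (r (φ a))) (cong (inv Q) (φ∘r (φ a))))) (invʳ Q (φ a)))

  ∙-∈K : ∀ z w → InKernel z → InKernel w → InKernel (_∙_ G z w)
  ∙-∈K z w z∈K w∈K = trans (φ-hom z w) (trans (cong₂ (_∙_ Q) z∈K w∈K) (idˡ Q (e Q)))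

  inv-∈K : ∀ z → InKernel z → InKernel (inv G z)
  inv-∈K z z∈K = trans (hom-inv G Q φ φ-hom z) (trans (cong (inv Q) z∈K) ε⁻¹≈ε)

  _·_ : Fin n → Fin n → Fin n
  a · b = ⟨ _∙_ H (φ a) (φ b) , _∙_ G (κ a) (κ b) ⟩

  ε : Fin n
  ε = ⟨ e H , e G ⟩

  _⁻¹ : Fin n → Fin n
  a ⁻¹ = ⟨ inv H (φ a) , inv G (κ a) ⟩

  φ-· : ∀ a b → φ (a · b) ≡ _∙_ H (φ a) (φ b)
  φ-· a b = φ-⟨,⟩ _ _ (∙-∈K _ _ (κ∈K a) (κ∈K b))

  κ-· : ∀ a b → κ (a · b) ≡ _∙_ G (κ a) (κ b)
  κ-· a b = κ-⟨,⟩ _ _ (∙-∈K _ _ (κ∈K a) (κ∈K b))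

  φ-ε : φ ε ≡ e H
  φ-ε = φ-⟨,⟩ _ _ (hom-e G Q φ φ-hom)

  κ-ε : κ ε ≡ e G
  κ-ε = κ-⟨,⟩ _ _ (hom-e G Q φ φ-hom)

  φ-⁻¹ : ∀ a → φ (a ⁻¹) ≡ inv H (φ a)
  φ-⁻¹ a = φ-⟨,⟩ _ _ (inv-∈K _ (κ∈K a))

  κ-⁻¹ : ∀ a → κ (a ⁻¹) ≡ inv G (κ a)
  κ-⁻¹ a = κ-⟨,⟩ _ _ (inv-∈K _ (κ∈K a))

  group : FinGroup n
  group = record
    { _∙_   = _·_
    ; e     = ε
    ; inv   = _⁻¹
    ; assoc = λ a b c → cong₂ ⟨_,_⟩
        (trans (cong (λ h → _∙_ H h (φ c)) (φ-· a b))
               (trans (assoc H (φ a) (φ b) (φ c)) (cong (_∙_ H (φ a)) (sym (φ-· b c)))))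
        (trans (cong (λ z → _∙_ G z (κ c)) (κ-· a b))
               (trans (assoc G (κ a) (κ b) (κ c)) (cong (_∙_ G (κ a)) (sym (κ-· b c)))))
    ; idˡ   = λ a → trans (cong₂ ⟨_,_⟩ (trans (cong (λ h → _∙_ H h (φ a)) φ-ε) (idˡ H (φ a)))
                                        (trans (cong (λ z → _∙_ G z (κ a)) κ-ε) (idˡ G (κ a)))) (⟨φ,κ⟩ a)
    ; idʳ   = λ a → trans (cong₂ ⟨_,_⟩ (trans (cong (_∙_ H (φ a)) φ-ε) (idʳ H (φ a)))
                                        (trans (cong (_∙_ G (κ a)) κ-ε) (idʳ G (κ a)))) (⟨φ,κ⟩ a)
    ; invˡ  = λ a → cong₂ ⟨_,_⟩ (trans (cong (λ h → _∙_ H h (φ a)) (φ-⁻¹ a)) (invˡ H (φ a)))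
                                 (trans (cong (λ z → _∙_ G z (κ a)) (κ-⁻¹ a)) (invˡ G (κ a)))
    ; invʳ  = λ a → cong₂ ⟨_,_⟩ (trans (cong (_∙_ H (φ a)) (φ-⁻¹ a)) (invʳ H (φ a)))
                                 (trans (cong (_∙_ G (κ a)) (κ-⁻¹ a)) (invʳ G (κ a)))
    }

  φ-isHom : IsHom group H φ
  φ-isHom = φ-·

trivialSubgroup : ∀ {n} → FinGroup n → Fin n → Bool
trivialSubgroup G x = ⌊ x FinP.≟ e G ⌋

module _ {n} (G : FinGroup n) where
  open GroupProperties (toGroup G) using (ε⁻¹≈ε)

  ∈-trivialSubgroup : ∀ {x} → x ≡ e G → trivialSubgroup G x ≡ true
  ∈-trivialSubgroup {x} x≡e with x FinP.≟ e G
  ... | yes _   = refl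
  ... | no  x≢e = ⊥-elim (x≢e x≡e)

  trivialSubgroup-≡e : ∀ x → trivialSubgroup G x ≡ true → x ≡ e G
  trivialSubgroup-≡e x with x FinP.≟ e G
  ... | yes x≡e = λ _ → x≡e
  ... | no  _   = λ ()

  trivialSubgroup-normal : IsNormalSubgroup G (trivialSubgroup G)
  trivialSubgroup-normal =
      ∈-trivialSubgroup refl
    , (λ x y x∈ y∈ → ∈-trivialSubgroup
                         (trans (cong₂ (_∙_ G) (trivialSubgroup-≡e x x∈) (trivialSubgroup-≡e y y∈)) (idˡ G (e G))))
    , (λ x x∈ → ∈-trivialSubgroup (trans (cong (inv G) (trivialSubgroup-≡e x x∈)) ε⁻¹≈ε))
    , (λ g x x∈ → ∈-trivialSubgroup (trans (cong (λ z → _∙_ G (_∙_ G g z) (inv G g)) (trivialSubgroup-≡e x x∈))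
                                            (trans (cong (λ z → _∙_ G z (inv G g)) (idʳ G g)) (invʳ G g))))

  quotient-by-trivialSubgroup : IsQuotientBy G (trivialSubgroup G) G
  quotient-by-trivialSubgroup =
    (λ x → x) , (λ x y → refl) , (λ q → q , refl) , (λ x → ∈-trivialSubgroup , trivialSubgroup-≡e x)

quotient-CayDS : ∀ {n k} (G : FinGroup n) (Q : FinGroup k) (φ : Fin n → Fin k) → IsHom G Q φ → Surj φ → CayDS G → CayDS Q
quotient-CayDS {n} {k} G Q φ φ-hom surj G-CayDS S S-conn m H T T-conn Q∼H
  with charPoly-≈ₚ⇒size-≡ k m (cayMatrix Q S) (cayMatrix H T) Q∼H
... | refl = cancel-blowUp φ surj μ μ≢0 fibres (cayAdj Q S) (cayAdj H T) (cayAdj-symmetric H T-conn) blowUps-isomorphic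
  where
  open ProductWithKernel G Q φ φ-hom surj H using (φ-isHom) renaming (group to H×K)
  μ : ℤ
  μ = fibreSize φ (e Q)
  μ≢0 : μ ≢ 0ℤ
  μ≢0 = fibreSize-nonzero φ surj (e Q)
  fibres : ∀ q → fibreSize φ q ≡ μ
  fibres = hom-fibreSize G Q φ φ-hom surj

  lifts-cospectral : Cospectral (cayAdj G (S ∘ φ)) (cayAdj H×K (T ∘ φ))
  lifts-cospectral =
    Cospectral-resp (λ a b → sym (cayAdj-pullback G Q φ φ-hom S a b)) (λ a b → sym (cayAdj-pullback H×K H φ φ-isHom T a b))
                    (cospectral-blowUp φ surj μ μ≢0 fibres (cayAdj Q S) (cayAdj H T) Q∼H)

  blowUps-isomorphic : blowUp φ (cayAdj Q S) ≅ blowUp φ (cayAdj H T)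
  blowUps-isomorphic = ≅-resp (cayAdj-pullback G Q φ φ-hom S) (cayAdj-pullback H×K H φ φ-isHom T)
    (G-CayDS (S ∘ φ) (connectionSet-pullback G Q φ φ-hom S-conn)
             n H×K (T ∘ φ) (connectionSet-pullback H×K H φ φ-isHom T-conn) lifts-cospectral)

theorem2p4 : ∀ n (G : FinGroup n) →
    CayDS G ⇔
      (∀ (N : Fin n → Bool) → IsNormalSubgroup G N →
        ∀ k (Q : FinGroup k) → IsQuotientBy G N Q → CayDS Q)
theorem2p4 n G = mk⇔
  (λ G-CayDS N _ k Q (φ , φ-hom , surj , _) → quotient-CayDS G Q φ φ-hom surj G-CayDS)
  (λ quotients-CayDS → quotients-CayDS (trivialSubgroup G) (trivialSubgroup-normal G) n G (quotient-by-trivialSubgroup G))
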